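{- There exist additive complements $A$ and $B$ such that $$\limsup_{x\to+\infty}\frac{A(x)B(x)}{x}\in \left(\tfrac{16}{9},2\right)\setminus\mathbb{Q}$$ and $A(x)B(x)-x=1$ for infinitely many positive integers $x$.
   Context: Two infinite sequences (sets) $A$ and $B$ of non-negative integers are called additive complements if their sumset $A+B=\{a+b: a\in A,\ b\in B\}$ contains all sufficiently large integers. For a set $S$ of non-negative integers, its counting function is $S(x)=\#\{s\in S: s\le x\}$. -}

module Defs where

open import Data.Bool using (Bool; true; false; if_then_else_)
open import Data.Nat using (ℕ; zero; suc; _+_; _*_; _≤_; _<_; _≥_)
open import Data.Product using (Σ; ∃; _×_; _,_)
open import Relation.Binary.PropositionalEquality using (_≡_)

SetN : Set
SetN = ℕ → Bool

_∈ₛ_ : ℕ → SetN → Set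
n ∈ₛ S = S n ≡ true

count : SetN → ℕ → ℕ
count S zero    = if S zero then 1 else 0
count S (suc x) = (if S (suc x) then 1 else 0) + count S x

InfinitelyOften : (ℕ → Set) → Set
InfinitelyOften P = ∀ n → ∃ λ m → n ≤ m × P m

Eventually : (ℕ → Set) → Set
Eventually P = ∃ λ N → ∀ n → N ≤ n → P n

Infinite : SetN → Set
Infinite S = InfinitelyOften (λ n → n ∈ₛ S)

AdditiveComplements : SetN → SetN → Set
AdditiveComplements A B =
  Infinite A × Infinite B ×
  Eventually (λ n → ∃ λ a → ∃ λ b → a ∈ₛ A × b ∈ₛ B × a + b ≡ n)

-- Non-negative rationals p / (suc d) are represented by the pair (p , d).
-- f(x) = A(x) B(x) / x  (for x ≥ 1).
--
-- limsup_{x→∞} A(x)B(x)/x  >  p/(1+d)  :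
--   there is a rational r = p'/(1+d') > p/(1+d) with f(x) ≥ r for infinitely many x ≥ 1.
LimsupGt : SetN → SetN → ℕ → ℕ → Set
LimsupGt A B p d =
  ∃ λ p' → ∃ λ d' →
    p * suc d' < p' * suc d ×
    InfinitelyOften (λ x → 1 ≤ x × p' * x ≤ suc d' * (count A x * count B x))

-- limsup_{x→∞} A(x)B(x)/x  <  p/(1+d)  :
--   there is a rational r = p'/(1+d') < p/(1+d) with f(x) ≤ r for all large x.
LimsupLt : SetN → SetN → ℕ → ℕ → Set
LimsupLt A B p d =
  ∃ λ p' → ∃ λ d' →
    p' * suc d < p * suc d' ×
    Eventually (λ x → suc d' * (count A x * count B x) ≤ p' * x)

-- Write numbers in the mixed radix with place values T₀ = 1, T_{k+1} = 2 h_k T_k, where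
-- h_k = 7 + e_k and e_k ∈ {0, 1, 2}. Let A be the numbers all of whose digits are 0 or h_k
-- and B those whose digits are below h_k. A digit c < 2 h_k is 0 + c or h_k + (c − h_k),
-- so A + B = ℕ, and A(T_k − 1) B(T_k − 1) = 2^k ∏ h_i = T_k.
--
-- On [T_k, T_{k+1}) the ratio A(x) B(x) / x is largest at one of two spikes, the main one at
-- x = h_k T_k + M_k, M_k = Σ_{i<k} h_i T_i, with value 2 h_k T_k / (h_k T_k + M_k); the bound
-- follows from two linear invariants for A(y) and B(y) on [0, T_k), proved digit by digit.
-- For k ≥ 1 both spike values are at most 36/19, and the main one is at least 9/5 when e_k = 2.
--
-- The digits e_k form the blocks W_j 2, where W_j read from the top is 0, 10, 110, …, 1^j 0.
-- At the 2 closing block j, M_k / T_k is pinned between two fractions r_j⁻ < r_j⁺ built from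
-- W_j, which tend monotonically to a common limit that determines the lim sup. A fraction
-- p/u cannot be the lim sup: after rescaling, the window (r_p⁻, r_p⁺) lies just above 8/15,
-- with length less than 8/(15 q) for some q > 8 p, too short to contain a fraction with
-- denominator p.

module Submission where

open import Defs
open import Data.Bool using (Bool; true; false; if_then_else_; _∧_; _∨_; T)
open import Data.Nat
open import Data.Nat.Properties
open import Data.Nat.DivMod
open import Data.Nat.Tactic.RingSolver
open import Algebra.Properties.CommutativeSemigroup *-commutativeSemigroup using (xy∙z≈xz∙y)
open import Data.List using (List; []; _∷_; [_]; _++_; length; replicate)
open import Data.List.Properties using (length-++; ++-assoc; ++-identityʳ)
open import Data.List.Relation.Unary.All using (All; []; _∷_)
import Data.List.Relation.Unary.All as All
open import Data.List.Relation.Unary.All.Properties using (++⁺; replicate⁺)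
open import Data.Product using (∃; _×_; _,_; proj₁; proj₂)
open import Data.Sum using (_⊎_; inj₁; inj₂)
open import Data.Empty using (⊥; ⊥-elim)
open import Data.Bool.Properties using (T-≡)
open import Function using (_∘_; Equivalence)
open import Relation.Nullary using (Dec; yes; no)
open import Relation.Binary.PropositionalEquality
  using (_≡_; _≢_; refl; sym; trans; cong; cong₂; subst; subst₂; module ≡-Reasoning)
open import Relation.Binary.Definitions using (tri<; tri≈; tri>)

-- Counting functions

indicator : Bool → ℕ
indicator b = if b then 1 else 0

countBelow : SetN → ℕ → ℕ
countBelow S zero    = 0
countBelow S (suc n) = indicator (S n) + countBelow S n

count≡countBelow : ∀ S x → count S x ≡ countBelow S (suc x)
count≡countBelow S zero    = sym (+-identityʳ _)
count≡countBelow S (suc x) = cong (indicator (S (suc x)) +_) (count≡countBelow S x)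

countBelow-+ : ∀ S m n → countBelow S (m + n) ≡ countBelow (λ i → S (m + i)) n + countBelow S m
countBelow-+ S m zero    rewrite +-identityʳ m = refl
countBelow-+ S m (suc n) rewrite +-suc m n | countBelow-+ S m n =
  sym (+-assoc (indicator (S (m + n))) _ _)

countBelow-cong : ∀ {S S′} n → (∀ i → i < n → S i ≡ S′ i) → countBelow S n ≡ countBelow S′ n
countBelow-cong zero    _  = refl
countBelow-cong (suc n) eq =
  cong₂ _+_ (cong indicator (eq n ≤-refl)) (countBelow-cong n (λ i i<n → eq i (m<n⇒m<1+n i<n)))

countBelow-mono : ∀ S {m n} → m ≤ n → countBelow S m ≤ countBelow S n
countBelow-mono S {m} {n} m≤n = subst (λ z → countBelow S m ≤ countBelow S z) (m+[n∸m]≡n m≤n)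
  (subst (countBelow S m ≤_) (sym (countBelow-+ S m (n ∸ m))) (m≤n+m _ _))

countBelow-∧ : ∀ b S n → countBelow (λ i → b ∧ S i) n ≡ indicator b * countBelow S n
countBelow-∧ true  S n = sym (*-identityˡ _)
countBelow-∧ false S zero    = refl
countBelow-∧ false S (suc n) = countBelow-∧ false S n

countBelow-<ᵇ : ∀ m n → countBelow (_<ᵇ m) n ≡ n ⊓ m
countBelow-<ᵇ m zero = refl
countBelow-<ᵇ m (suc n) with n <ᵇ m in eq
... | true  = trans (cong suc (trans (countBelow-<ᵇ m n) (m≤n⇒m⊓n≡m (<⇒≤ n<m)))) (sym (m≤n⇒m⊓n≡m n<m))
  where n<m = <ᵇ⇒< n m (subst T (sym eq) _)
... | false = trans (countBelow-<ᵇ m n) (trans (m≥n⇒m⊓n≡n m≤n) (sym (m≥n⇒m⊓n≡n (m≤n⇒m≤1+n m≤n))))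
  where m≤n = ≮⇒≥ (λ n<m → subst T eq (<⇒<ᵇ n<m))

≡ᵇ-refl : ∀ n → (n ≡ᵇ n) ≡ true
≡ᵇ-refl zero    = refl
≡ᵇ-refl (suc n) = ≡ᵇ-refl n

≢⇒≡ᵇ-false : ∀ {m n} → m ≢ n → (m ≡ᵇ n) ≡ false
≢⇒≡ᵇ-false {zero}  {zero}  m≢n = ⊥-elim (m≢n refl)
≢⇒≡ᵇ-false {zero}  {suc n} _   = refl
≢⇒≡ᵇ-false {suc m} {zero}  _   = refl
≢⇒≡ᵇ-false {suc m} {suc n} m≢n = ≢⇒≡ᵇ-false (m≢n ∘ cong suc)

<⇒<ᵇ-true : ∀ {m n} → m < n → (m <ᵇ n) ≡ true
<⇒<ᵇ-true m<n = Equivalence.to T-≡ (<⇒<ᵇ m<n)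

≤⇒<ᵇ-false : ∀ {m n} → n ≤ m → (m <ᵇ n) ≡ false
≤⇒<ᵇ-false {m} {n} n≤m with m <ᵇ n in eq
... | false = refl
... | true  = ⊥-elim (<⇒≱ (<ᵇ⇒< m n (subst T (sym eq) _)) n≤m)

countBelow-product : ∀ (S P Q : SetN) {C T} →
  (∀ c r → c < C → r < T → S (c * T + r) ≡ (P c ∧ Q r)) →
  ∀ c y → c < C → y ≤ T →
  countBelow S (c * T + y) ≡ countBelow P c * countBelow Q T + indicator (P c) * countBelow Q y
countBelow-product S P Q {C} {T} split zero y 0<C y≤T =
  trans (countBelow-cong y (λ i i<y → split 0 i 0<C (<-≤-trans i<y y≤T))) (countBelow-∧ (P 0) Q y)
countBelow-product S P Q {C} {T} split (suc c) y c<C y≤T = begin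
    countBelow S (suc c * T + y)
      ≡⟨ countBelow-+ S (suc c * T) y ⟩
    countBelow (λ i → S (suc c * T + i)) y + countBelow S (T + c * T)
      ≡⟨ cong₂ _+_ top-block (cong (countBelow S) (+-comm T (c * T))) ⟩
    p′ * q y + countBelow S (c * T + T)
      ≡⟨ cong (p′ * q y +_) (countBelow-product S P Q split c T (<-trans (n<1+n c) c<C) ≤-refl) ⟩
    p′ * q y + (countBelow P c * q T + p * q T)
      ≡⟨ regroup p′ (q y) (countBelow P c) (q T) p ⟩
    (p + countBelow P c) * q T + p′ * q y ∎
  where
  open ≡-Reasoning
  q = countBelow Q
  p = indicator (P c)
  p′ = indicator (P (suc c))
  regroup : ∀ a b c d e → a * b + (c * d + e * d) ≡ (e + c) * d + a * b
  regroup = solve-∀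
  top-block : countBelow (λ i → S (suc c * T + i)) y ≡ p′ * q y
  top-block = trans (countBelow-cong y (λ i i<y → split (suc c) i c<C (<-≤-trans i<y y≤T)))
                    (countBelow-∧ (P (suc c)) Q y)

-- Mixed radix numeration

module MixedRadix (radix : ℕ → ℕ) (1<radix : ∀ k → 1 < radix k) where

  place : ℕ → ℕ
  place zero    = 1
  place (suc k) = radix k * place k

  place>0 : ∀ k → 0 < place k
  place>0 zero    = z<s
  place>0 (suc k) = *-mono-≤ (<⇒≤ (1<radix k)) (place>0 k)

  place-nonZero : ∀ k → NonZero (place k)
  place-nonZero k = >-nonZero (place>0 k)

  high low : ℕ → ℕ → ℕ
  high k n = _/_ n (place k) ⦃ place-nonZero k ⦄
  low  k n = _%_ n (place k) ⦃ place-nonZero k ⦄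

  place+place≤place-suc : ∀ k → place k + place k ≤ place (suc k)
  place+place≤place-suc k = begin
    place k + place k     ≡⟨ cong (place k +_) (sym (+-identityʳ (place k))) ⟩
    2 * place k           ≤⟨ *-monoˡ-≤ (place k) (1<radix k) ⟩
    radix k * place k     ∎
    where open ≤-Reasoning

  place-mono : ∀ {k k′} → k ≤ k′ → place k ≤ place k′
  place-mono = go ∘ ≤⇒≤′
    where
    go : ∀ {k k′} → k ≤′ k′ → place k ≤ place k′
    go ≤′-refl        = ≤-refl
    go (≤′-step k≤′k′) = ≤-trans (go k≤′k′) (≤-trans (m≤m+n _ _) (place+place≤place-suc _))

  k<place : ∀ k → k < place k
  k<place zero    = z<s
  k<place (suc k) = ≤-trans (+-mono-≤ (place>0 k) (k<place k)) (place+place≤place-suc k)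

  digits<place : ∀ {k c r} → c < radix k → r < place k → c * place k + r < place (suc k)
  digits<place {k} {c} {r} c<radix r<place = begin-strict
    c * place k + r        <⟨ +-monoʳ-< (c * place k) r<place ⟩
    c * place k + place k  ≡⟨ +-comm (c * place k) (place k) ⟩
    suc c * place k        ≤⟨ *-monoˡ-≤ (place k) c<radix ⟩
    radix k * place k      ∎
    where open ≤-Reasoning

  high-digits : ∀ {k} c {r} → r < place k → high k (c * place k + r) ≡ c
  high-digits {k} c {r} r<place = begin
    (c * P + r) / P   ≡⟨ +-distrib-/ (c * P) r no-carry ⟩
    c * P / P + r / P ≡⟨ cong₂ _+_ (m*n/n≡m c P) (m<n⇒m/n≡0 r<place) ⟩
    c + 0             ≡⟨ +-identityʳ c ⟩
    c                 ∎
    where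
    open ≡-Reasoning
    P = place k
    instance _ = place-nonZero k
    no-carry : c * P % P + r % P < P
    no-carry = subst (_< P) (sym (cong₂ _+_ (m*n%n≡0 c P) (m<n⇒m%n≡m r<place))) r<place

  low-digits : ∀ {k} c {r} → r < place k → low k (c * place k + r) ≡ r
  low-digits {k} c {r} r<place = begin
    (c * P + r) % P ≡⟨ cong (_% P) (+-comm (c * P) r) ⟩
    (r + c * P) % P ≡⟨ [m+kn]%n≡m%n r c P ⟩
    r % P           ≡⟨ m<n⇒m%n≡m r<place ⟩
    r               ∎
    where
    open ≡-Reasoning
    P = place k
    instance _ = place-nonZero k

  high-small : ∀ {k n} → n < place k → high k n ≡ 0
  high-small {k} = m<n⇒m/n≡0 ⦃ place-nonZero k ⦄

  low-small : ∀ {k n} → n < place k → low k n ≡ n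
  low-small {k} = m<n⇒m%n≡m ⦃ place-nonZero k ⦄

  digits-view : ∀ {k n} → n < place (suc k) →
    ∃ λ c → ∃ λ r → c < radix k × r < place k × n ≡ c * place k + r
  digits-view {k} {n} n<place =
    high k n , low k n , m<n*o⇒m/o<n ⦃ place-nonZero k ⦄ n<place , m%n<n n (place k) ⦃ place-nonZero k ⦄ ,
    trans (m≡m%n+[m/n]*n n (place k) ⦃ place-nonZero k ⦄) (+-comm (low k n) _)

  module DigitSet (allowed : ℕ → ℕ → Bool) (0-allowed : ∀ k → allowed k 0 ≡ true) where

    lowDigitsAllowed : ℕ → ℕ → Bool
    lowDigitsAllowed zero    n = true
    lowDigitsAllowed (suc k) n = allowed k (high k n) ∧ lowDigitsAllowed k (low k n)

    -- Since n < place n, all nonzero digits of n are among its n lowest ones.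
    digitSet : SetN
    digitSet n = lowDigitsAllowed n n

    lowDigitsAllowed-stable : ∀ {k k′ n} → n < place k → k ≤ k′ →
      lowDigitsAllowed k′ n ≡ lowDigitsAllowed k n
    lowDigitsAllowed-stable n<place = go n<place ∘ ≤⇒≤′
      where
      go : ∀ {k k′ n} → n < place k → k ≤′ k′ → lowDigitsAllowed k′ n ≡ lowDigitsAllowed k n
      go n<place ≤′-refl = refl
      go {k} {suc k′} {n} n<place (≤′-step k≤′k′) = begin
        allowed k′ (high k′ n) ∧ lowDigitsAllowed k′ (low k′ n)
          ≡⟨ cong₂ (λ d m → allowed k′ d ∧ lowDigitsAllowed k′ m) (high-small {k′} n<P) (low-small {k′} n<P) ⟩
        allowed k′ 0 ∧ lowDigitsAllowed k′ n
          ≡⟨ cong (_∧ lowDigitsAllowed k′ n) (0-allowed k′) ⟩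
        lowDigitsAllowed k′ n
          ≡⟨ go n<place k≤′k′ ⟩
        lowDigitsAllowed k n ∎
        where
        open ≡-Reasoning
        n<P = <-≤-trans n<place (place-mono (≤′⇒≤ k≤′k′))

    digitSet≡lowDigitsAllowed : ∀ {k n} → n < place k → digitSet n ≡ lowDigitsAllowed k n
    digitSet≡lowDigitsAllowed {k} {n} n<place with ≤-total n k
    ... | inj₁ n≤k = sym (lowDigitsAllowed-stable (k<place n) n≤k)
    ... | inj₂ k≤n = lowDigitsAllowed-stable n<place k≤n

    digitSet-digits : ∀ {k c r} → c < radix k → r < place k →
      digitSet (c * place k + r) ≡ (allowed k c ∧ digitSet r)
    digitSet-digits {k} {c} {r} c<radix r<place = begin
      digitSet (c * place k + r)
        ≡⟨ digitSet≡lowDigitsAllowed {suc k} (digits<place c<radix r<place) ⟩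
      allowed k (high k (c * place k + r)) ∧ lowDigitsAllowed k (low k (c * place k + r))
        ≡⟨ cong₂ (λ d m → allowed k d ∧ lowDigitsAllowed k m) (high-digits {k} c r<place) (low-digits {k} c r<place) ⟩
      allowed k c ∧ lowDigitsAllowed k r
        ≡⟨ cong (allowed k c ∧_) (sym (digitSet≡lowDigitsAllowed {k} r<place)) ⟩
      allowed k c ∧ digitSet r ∎
      where open ≡-Reasoning

    countBelow-digitSet : ∀ {k} c y → c < radix k → y ≤ place k →
      countBelow digitSet (c * place k + y)
        ≡ countBelow (allowed k) c * countBelow digitSet (place k) + indicator (allowed k c) * countBelow digitSet y
    countBelow-digitSet {k} = countBelow-product digitSet (allowed k) digitSet
      (λ c r c<radix r<place → digitSet-digits c<radix r<place)

    count-digitSet : ∀ {k} c y → c < radix k → y < place k →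
      count digitSet (c * place k + y)
        ≡ countBelow (allowed k) c * countBelow digitSet (place k) + indicator (allowed k c) * count digitSet y
    count-digitSet {k} c y c<radix y<place = begin
      count digitSet (c * place k + y)
        ≡⟨ count≡countBelow digitSet (c * place k + y) ⟩
      countBelow digitSet (suc (c * place k + y))
        ≡⟨ cong (countBelow digitSet) (sym (+-suc (c * place k) y)) ⟩
      countBelow digitSet (c * place k + suc y)
        ≡⟨ countBelow-digitSet c (suc y) c<radix y<place ⟩
      full-blocks + indicator (allowed k c) * countBelow digitSet (suc y)
        ≡⟨ cong (λ m → full-blocks + indicator (allowed k c) * m) (sym (count≡countBelow digitSet y)) ⟩
      full-blocks + indicator (allowed k c) * count digitSet y ∎
      where
      open ≡-Reasoning
      full-blocks = countBelow (allowed k) c * countBelow digitSet (place k)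

    countBelow-digitSet-place : ∀ k →
      countBelow digitSet (place (suc k)) ≡ countBelow (allowed k) (radix k) * countBelow digitSet (place k)
    countBelow-digitSet-place k = begin
      countBelow digitSet (radix k * P)
        ≡⟨ cong (λ r → countBelow digitSet (r * P)) (sym radix≡suc-c) ⟩
      countBelow digitSet (P + c * P)
        ≡⟨ cong (countBelow digitSet) (+-comm P (c * P)) ⟩
      countBelow digitSet (c * P + P)
        ≡⟨ countBelow-digitSet c P (≤-reflexive radix≡suc-c) ≤-refl ⟩
      countBelow (allowed k) c * N + indicator (allowed k c) * N
        ≡⟨ trans (sym (*-distribʳ-+ N (countBelow (allowed k) c) (indicator (allowed k c))))
                 (cong (_* N) (+-comm (countBelow (allowed k) c) (indicator (allowed k c)))) ⟩
      countBelow (allowed k) (suc c) * N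
        ≡⟨ cong (λ r → countBelow (allowed k) r * N) radix≡suc-c ⟩
      countBelow (allowed k) (radix k) * N ∎
      where
      open ≡-Reasoning
      P = place k
      N = countBelow digitSet P
      c = pred (radix k)
      radix≡suc-c : suc c ≡ radix k
      radix≡suc-c = suc-pred (radix k) ⦃ >-nonZero (<-trans z<s (1<radix k)) ⦄

countBelow-zeroOr-≤ : ∀ m {c} → 0 < c → c ≤ suc m → countBelow (λ i → (i ≡ᵇ 0) ∨ (i ≡ᵇ suc m)) c ≡ 1
countBelow-zeroOr-≤ m {suc zero}    _ _ = refl
countBelow-zeroOr-≤ m {suc (suc c)} _ (s≤s c<m) =
  cong₂ _+_ (cong indicator (≢⇒≡ᵇ-false (<⇒≢ c<m))) (countBelow-zeroOr-≤ m z<s (<⇒≤ (s≤s c<m)))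

countBelow-zeroOr-> : ∀ m {c} → suc m < c → countBelow (λ i → (i ≡ᵇ 0) ∨ (i ≡ᵇ suc m)) c ≡ 2
countBelow-zeroOr-> m {suc c} (s≤s sm≤c) with m≤n⇒m<n∨m≡n sm≤c
... | inj₂ refl = cong₂ _+_ (cong indicator (≡ᵇ-refl m)) (countBelow-zeroOr-≤ m z<s ≤-refl)
... | inj₁ (s≤s m<c′) =
  cong₂ _+_ (cong indicator (≢⇒≡ᵇ-false (>⇒≢ m<c′))) (countBelow-zeroOr-> m (s≤s m<c′))

-- Read a * d ≤ c * b as a / b ≤ c / d.
frac-≤-trans : ∀ {a b c d e f} → 0 < d → a * d ≤ c * b → c * f ≤ e * d → a * f ≤ e * b
frac-≤-trans {a} {b} {c} {d} {e} {f} d>0 ad≤cb cf≤ed = *-cancelʳ-≤ (a * f) (e * b) d ⦃ >-nonZero d>0 ⦄ (begin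
  a * f * d  ≡⟨ xy∙z≈xz∙y a f d ⟩
  a * d * f  ≤⟨ *-monoˡ-≤ f ad≤cb ⟩
  c * b * f  ≡⟨ xy∙z≈xz∙y c b f ⟩
  c * f * b  ≤⟨ *-monoˡ-≤ b cf≤ed ⟩
  e * d * b  ≡⟨ xy∙z≈xz∙y e d b ⟩
  e * b * d  ∎)
  where open ≤-Reasoning

frac-≤-<-trans : ∀ {a b c d e f} → 0 < b → a * d ≤ c * b → c * f < e * d → a * f < e * b
frac-≤-<-trans {a} {b} {c} {d} {e} {f} b>0 ad≤cb cf<ed = *-cancelʳ-< d (a * f) (e * b) (begin-strict
  a * f * d  ≡⟨ xy∙z≈xz∙y a f d ⟩
  a * d * f  ≤⟨ *-monoˡ-≤ f ad≤cb ⟩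
  c * b * f  ≡⟨ xy∙z≈xz∙y c b f ⟩
  c * f * b  <⟨ *-monoˡ-< b ⦃ >-nonZero b>0 ⦄ cf<ed ⟩
  e * d * b  ≡⟨ xy∙z≈xz∙y e d b ⟩
  e * b * d  ∎)
  where open ≤-Reasoning

frac-<-≤-trans : ∀ {a b c d e f} → 0 < f → a * d < c * b → c * f ≤ e * d → a * f < e * b
frac-<-≤-trans {a} {b} {c} {d} {e} {f} f>0 ad<cb cf≤ed = *-cancelʳ-< d (a * f) (e * b) (begin-strict
  a * f * d  ≡⟨ xy∙z≈xz∙y a f d ⟩
  a * d * f  <⟨ *-monoˡ-< f ⦃ >-nonZero f>0 ⦄ ad<cb ⟩
  c * b * f  ≡⟨ xy∙z≈xz∙y c b f ⟩
  c * f * b  ≤⟨ *-monoˡ-≤ b cf≤ed ⟩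
  e * d * b  ≡⟨ xy∙z≈xz∙y e d b ⟩
  e * b * d  ∎)
  where open ≤-Reasoning

scale-slack : ∀ n {v m t y} → v ≤ t → v + m ≤ t + y → suc n * v + m ≤ suc n * t + y
scale-slack n {v} {m} {t} {y} v≤t slack = begin
  suc n * v + m     ≡⟨ +-comm (v + n * v) m ⟩
  m + (v + n * v)   ≡⟨ sym (+-assoc m v (n * v)) ⟩
  (m + v) + n * v   ≤⟨ +-mono-≤ (≤-reflexive (+-comm m v)) (*-monoʳ-≤ n v≤t) ⟩
  (v + m) + n * t   ≤⟨ +-monoˡ-≤ (n * t) slack ⟩
  (t + y) + n * t   ≡⟨ swap t y (n * t) ⟩
  suc n * t + y     ∎
  where
  open ≤-Reasoning
  swap : ∀ t y u → (t + y) + u ≡ (t + u) + y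
  swap = solve-∀

halve-slack : ∀ {v m t y} → v ≤ t → v + 2 * m ≤ t + 2 * y → v + m ≤ t + y
halve-slack {v} {m} {t} {y} v≤t slack = *-cancelˡ-≤ 2 (begin
  2 * (v + m)        ≡⟨ split v m ⟩
  v + (v + 2 * m)    ≤⟨ +-mono-≤ v≤t slack ⟩
  t + (t + 2 * y)    ≡⟨ sym (split t y) ⟩
  2 * (t + y)        ∎)
  where
  open ≤-Reasoning
  split : ∀ v m → 2 * (v + m) ≡ v + (v + 2 * m)
  split = solve-∀

product-bound-low-digit : ∀ c {β m t y} → β ≤ t → m ≤ t → β + 2 * m ≤ t + 2 * y →
  (suc c * t + β) * (t + m) ≤ 2 * t * (suc c * t + y)
product-bound-low-digit c {β} {m} {t} {y} β≤t m≤t slack = begin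
  (suc c * t + β) * (t + m)
    ≡⟨ expand c β m t ⟩
  (t * t + c * t * t + t * β + t * m) + (c * t * m + β * m)
    ≤⟨ +-monoʳ-≤ (t * t + c * t * t + t * β + t * m) (+-mono-≤ (*-monoʳ-≤ (c * t) m≤t) (*-monoˡ-≤ m β≤t)) ⟩
  (t * t + c * t * t + t * β + t * m) + (c * t * t + t * m)
    ≡⟨ collect c β m t ⟩
  (t * t + 2 * (c * t * t)) + t * (β + 2 * m)
    ≤⟨ +-monoʳ-≤ (t * t + 2 * (c * t * t)) (*-monoʳ-≤ t slack) ⟩
  (t * t + 2 * (c * t * t)) + t * (t + 2 * y)
    ≡⟨ finish c t y ⟩
  2 * t * (suc c * t + y) ∎
  where
  open ≤-Reasoning
  expand : ∀ c β m t → (suc c * t + β) * (t + m) ≡ (t * t + c * t * t + t * β + t * m) + (c * t * m + β * m)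
  expand = solve-∀
  collect : ∀ c β m t → (t * t + c * t * t + t * β + t * m) + (c * t * t + t * m) ≡ (t * t + 2 * (c * t * t)) + t * (β + 2 * m)
  collect = solve-∀
  finish : ∀ c t y → (t * t + 2 * (c * t * t)) + t * (t + 2 * y) ≡ 2 * t * (suc c * t + y)
  finish = solve-∀

product-bound-middle-digit : ∀ g {v m t y} → v ≤ t → v + m ≤ t + y →
  (t + v) * (suc (suc g) * t + m) ≤ 2 * t * (suc (suc g) * t + y)
product-bound-middle-digit g {v} {m} {t} {y} v≤t slack = begin
  (t + v) * (suc (suc g) * t + m)
    ≡⟨ expand g v m t ⟩
  (suc (suc g) * t * t + 2 * t * v + t * m) + (g * v * t + v * m)
    ≤⟨ +-monoʳ-≤ (suc (suc g) * t * t + 2 * t * v + t * m) (+-mono-≤ (*-monoˡ-≤ t (*-monoʳ-≤ g v≤t)) (*-monoˡ-≤ m v≤t)) ⟩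
  (suc (suc g) * t * t + 2 * t * v + t * m) + (g * t * t + t * m)
    ≡⟨ collect g v m t ⟩
  (suc (suc g) * t * t + g * t * t) + 2 * t * (v + m)
    ≤⟨ +-monoʳ-≤ (suc (suc g) * t * t + g * t * t) (*-monoʳ-≤ (2 * t) slack) ⟩
  (suc (suc g) * t * t + g * t * t) + 2 * t * (t + y)
    ≡⟨ finish g t y ⟩
  2 * t * (suc (suc g) * t + y) ∎
  where
  open ≤-Reasoning
  expand : ∀ g v m t → (t + v) * (suc (suc g) * t + m) ≡ (suc (suc g) * t * t + 2 * t * v + t * m) + (g * v * t + v * m)
  expand = solve-∀
  collect : ∀ g v m t → (suc (suc g) * t * t + 2 * t * v + t * m) + (g * t * t + t * m) ≡ (suc (suc g) * t * t + g * t * t) + 2 * t * (v + m)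
  collect = solve-∀
  finish : ∀ g t y → (suc (suc g) * t * t + g * t * t) + 2 * t * (t + y) ≡ 2 * t * (suc (suc g) * t + y)
  finish = solve-∀

-- The default 1 is never used: digitSeq only looks up in-range positions.
nth : List ℕ → ℕ → ℕ
nth []       _       = 1
nth (x ∷ xs) zero    = x
nth (x ∷ xs) (suc i) = nth xs i

nth-++ˡ : ∀ xs ys {i} → i < length xs → nth (xs ++ ys) i ≡ nth xs i
nth-++ˡ (x ∷ xs) ys {zero}  _         = refl
nth-++ˡ (x ∷ xs) ys {suc i} (s≤s i<n) = nth-++ˡ xs ys i<n

nth-++ʳ : ∀ xs ys i → nth (xs ++ ys) (length xs + i) ≡ nth ys i
nth-++ʳ []       ys i = refl
nth-++ʳ (x ∷ xs) ys i = nth-++ʳ xs ys i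

nth-++ : ∀ xs ys i →
  (i < length xs × nth (xs ++ ys) i ≡ nth xs i) ⊎ (∃ λ i′ → i ≡ length xs + i′ × nth (xs ++ ys) i ≡ nth ys i′)
nth-++ xs ys i with i <? length xs
... | yes i<n = inj₁ (i<n , nth-++ˡ xs ys i<n)
... | no  i≮n = inj₂ (i ∸ length xs , sym n+i′≡i , trans (cong (nth (xs ++ ys)) (sym n+i′≡i)) (nth-++ʳ xs ys (i ∸ length xs)))
  where n+i′≡i = m+[n∸m]≡n (≮⇒≥ i≮n)

nth-≤ : ∀ {m} xs i → 1 ≤ m → All (_≤ m) xs → nth xs i ≤ m
nth-≤ []       i       1≤m []         = 1≤m
nth-≤ (x ∷ xs) zero    _   (x≤m ∷ _)  = x≤m
nth-≤ (x ∷ xs) (suc i) 1≤m (_ ∷ xs≤m) = nth-≤ xs i 1≤m xs≤m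

-- The factor by which a run of digits (lowest first) multiplies the place value, and the
-- part of the largest element of A that the run contributes (see place-run and maxA-run).
wordPlace wordMax : List ℕ → ℕ
wordPlace []      = 1
wordPlace (x ∷ L) = wordPlace L * (2 * (7 + x))
wordMax []        = 0
wordMax (x ∷ L)   = wordMax L * (2 * (7 + x)) + (7 + x)

-- The construction for an arbitrary digit sequence e

module Construction (e : ℕ → ℕ) where

  h : ℕ → ℕ
  h k = 7 + e k

  h<2h : ∀ k → h k < 2 * h k
  h<2h k = m<m+n (h k) z<s

  open MixedRadix (λ k → 2 * h k) (λ _ → s≤s (s≤s z≤n)) public

  zeroOrH belowH : ℕ → ℕ → Bool
  zeroOrH k c = (c ≡ᵇ 0) ∨ (c ≡ᵇ h k)
  belowH  k c = c <ᵇ h k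

  module 𝒜 = DigitSet zeroOrH (λ _ → refl)
  module ℬ = DigitSet belowH  (λ _ → refl)

  A B : SetN
  A = 𝒜.digitSet
  B = ℬ.digitSet

  a b : ℕ → ℕ
  a k = countBelow A (place k)
  b k = countBelow B (place k)

  a-suc : ∀ k → a (suc k) ≡ 2 * a k
  a-suc k = trans (𝒜.countBelow-digitSet-place k) (cong (_* a k) (countBelow-zeroOr-> (6 + e k) (h<2h k)))

  b-suc : ∀ k → b (suc k) ≡ h k * b k
  b-suc k = trans (ℬ.countBelow-digitSet-place k)
    (cong (_* b k) (trans (countBelow-<ᵇ (h k) (2 * h k)) (m≥n⇒m⊓n≡n (<⇒≤ (h<2h k)))))

  a*b≡place : ∀ k → a k * b k ≡ place k
  a*b≡place zero    = refl
  a*b≡place (suc k) = begin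
    a (suc k) * b (suc k)   ≡⟨ cong₂ _*_ (a-suc k) (b-suc k) ⟩
    2 * a k * (h k * b k)   ≡⟨ interchange (a k) (b k) (h k) ⟩
    2 * h k * (a k * b k)   ≡⟨ cong (2 * h k *_) (a*b≡place k) ⟩
    2 * h k * place k       ∎
    where
    open ≡-Reasoning
    interchange : ∀ x y z → 2 * x * (z * y) ≡ 2 * z * (x * y)
    interchange = solve-∀

  count-A-between : ∀ {k c y} → 0 < c → c < h k → y < place k → count A (c * place k + y) ≡ a k
  count-A-between {k} {suc c} {y} _ c<h y<place = begin
    count A (suc c * place k + y)
      ≡⟨ 𝒜.count-digitSet (suc c) y (<-trans c<h (h<2h k)) y<place ⟩
    countBelow (zeroOrH k) (suc c) * a k + indicator (zeroOrH k (suc c)) * count A y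
      ≡⟨ cong₂ (λ m i → m * a k + indicator i * count A y)
               (countBelow-zeroOr-≤ (6 + e k) z<s (<⇒≤ c<h)) (≢⇒≡ᵇ-false (<⇒≢ c<h)) ⟩
    1 * a k + 0
      ≡⟨ trans (+-identityʳ _) (*-identityˡ _) ⟩
    a k ∎
    where open ≡-Reasoning

  count-A-h : ∀ {k y} → y < place k → count A (h k * place k + y) ≡ a k + count A y
  count-A-h {k} {y} y<place = begin
    count A (h k * place k + y)
      ≡⟨ 𝒜.count-digitSet (h k) y (h<2h k) y<place ⟩
    countBelow (zeroOrH k) (h k) * a k + indicator (zeroOrH k (h k)) * count A y
      ≡⟨ cong₂ (λ m i → m * a k + indicator i * count A y)
               (countBelow-zeroOr-≤ (6 + e k) z<s ≤-refl) (≡ᵇ-refl (h k)) ⟩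
    1 * a k + 1 * count A y
      ≡⟨ cong₂ _+_ (*-identityˡ (a k)) (*-identityˡ (count A y)) ⟩
    a k + count A y ∎
    where open ≡-Reasoning

  count-A-above : ∀ {k c y} → h k < c → c < 2 * h k → y < place k → count A (c * place k + y) ≡ 2 * a k
  count-A-above {k} {suc c} {y} h<c c<2h y<place = begin
    count A (suc c * place k + y)
      ≡⟨ 𝒜.count-digitSet (suc c) y c<2h y<place ⟩
    countBelow (zeroOrH k) (suc c) * a k + indicator (zeroOrH k (suc c)) * count A y
      ≡⟨ cong₂ (λ m i → m * a k + indicator i * count A y)
               (countBelow-zeroOr-> (6 + e k) h<c) (≢⇒≡ᵇ-false (>⇒≢ h<c)) ⟩
    2 * a k + 0
      ≡⟨ +-identityʳ _ ⟩
    2 * a k ∎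
    where open ≡-Reasoning

  count-B-below : ∀ {k c y} → c < h k → y < place k → count B (c * place k + y) ≡ c * b k + count B y
  count-B-below {k} {c} {y} c<h y<place = begin
    count B (c * place k + y)
      ≡⟨ ℬ.count-digitSet c y (<-trans c<h (h<2h k)) y<place ⟩
    countBelow (belowH k) c * b k + indicator (belowH k c) * count B y
      ≡⟨ cong₂ (λ m i → m * b k + indicator i * count B y)
               (trans (countBelow-<ᵇ (h k) c) (m≤n⇒m⊓n≡m (<⇒≤ c<h))) (<⇒<ᵇ-true c<h) ⟩
    c * b k + 1 * count B y
      ≡⟨ cong (c * b k +_) (*-identityˡ _) ⟩
    c * b k + count B y ∎
    where open ≡-Reasoning

  count-B-above : ∀ {k c y} → h k ≤ c → c < 2 * h k → y < place k → count B (c * place k + y) ≡ h k * b k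
  count-B-above {k} {c} {y} h≤c c<2h y<place = begin
    count B (c * place k + y)
      ≡⟨ ℬ.count-digitSet c y c<2h y<place ⟩
    countBelow (belowH k) c * b k + indicator (belowH k c) * count B y
      ≡⟨ cong₂ (λ m i → m * b k + indicator i * count B y)
               (trans (countBelow-<ᵇ (h k) c) (m≥n⇒m⊓n≡n h≤c)) (≤⇒<ᵇ-false h≤c) ⟩
    h k * b k + 0
      ≡⟨ +-identityʳ _ ⟩
    h k * b k ∎
    where open ≡-Reasoning

  maxA maxB : ℕ → ℕ
  maxA zero    = 0
  maxA (suc k) = h k * place k + maxA k
  maxB zero    = 0
  maxB (suc k) = (6 + e k) * place k + maxB k

  h*place+place≤place-suc : ∀ k → h k * place k + place k ≤ place (suc k)
  h*place+place≤place-suc k = begin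
    h k * place k + place k ≡⟨ +-comm (h k * place k) (place k) ⟩
    suc (h k) * place k     ≤⟨ *-monoˡ-≤ (place k) (h<2h k) ⟩
    2 * h k * place k       ∎
    where open ≤-Reasoning

  maxA<place : ∀ k → maxA k < place k
  maxA<place zero    = z<s
  maxA<place (suc k) = <-≤-trans (+-monoʳ-< (h k * place k) (maxA<place k)) (h*place+place≤place-suc k)

  maxB<place : ∀ k → maxB k < place k
  maxB<place zero    = z<s
  maxB<place (suc k) = begin-strict
    (6 + e k) * place k + maxB k  <⟨ +-monoʳ-< ((6 + e k) * place k) (maxB<place k) ⟩
    (6 + e k) * place k + place k ≡⟨ +-comm ((6 + e k) * place k) (place k) ⟩
    h k * place k                 ≤⟨ m≤m+n (h k * place k) (place k) ⟩
    h k * place k + place k       ≤⟨ h*place+place≤place-suc k ⟩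
    place (suc k)                 ∎
    where open ≤-Reasoning

  count-A-maxA : ∀ k → count A (maxA k) ≡ a k
  count-A-maxA zero    = refl
  count-A-maxA (suc k) = begin
    count A (h k * place k + maxA k) ≡⟨ count-A-h {k} (maxA<place k) ⟩
    a k + count A (maxA k)           ≡⟨ cong (a k +_) (count-A-maxA k) ⟩
    a k + a k                        ≡⟨ cong (a k +_) (sym (+-identityʳ (a k))) ⟩
    2 * a k                          ≡⟨ sym (a-suc k) ⟩
    a (suc k)                        ∎
    where open ≡-Reasoning

  count-A≤a : ∀ {k y} → y < place k → count A y ≤ a k
  count-A≤a {k} {y} y<place = subst (_≤ a k) (sym (count≡countBelow A y)) (countBelow-mono A y<place)

  count-B≤b : ∀ {k y} → y < place k → count B y ≤ b k
  count-B≤b {k} {y} y<place = subst (_≤ b k) (sym (count≡countBelow B y)) (countBelow-mono B y<place)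

  b*count-A≤place : ∀ {k y} → y < place k → b k * count A y ≤ place k
  b*count-A≤place {k} y<place =
    ≤-trans (*-monoʳ-≤ (b k) (count-A≤a {k} y<place)) (≤-reflexive (trans (*-comm (b k) (a k)) (a*b≡place k)))

  a*count-B≤place : ∀ {k y} → y < place k → a k * count B y ≤ place k
  a*count-B≤place {k} y<place = ≤-trans (*-monoʳ-≤ (a k) (count-B≤b {k} y<place)) (≤-reflexive (a*b≡place k))

  h*b*a≡h*place : ∀ k → h k * b k * a k ≡ h k * place k
  h*b*a≡h*place k = trans (*-assoc (h k) (b k) (a k)) (cong (h k *_) (trans (*-comm (b k) (a k)) (a*b≡place k)))

  InvA : ℕ → ℕ → Set
  InvA k y = b k * count A y + maxA k ≤ place k + y

  invA-digit-0 : ∀ k {y} → y < place k → InvA k y →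
    h k * b k * count A y + maxA (suc k) ≤ place (suc k) + y
  invA-digit-0 k {y} y<P inv = begin
    H * b k * count A y + (H * P + maxA k)    ≡⟨ regroup H (b k) (count A y) P (maxA k) ⟩
    H * P + (H * (b k * count A y) + maxA k)  ≤⟨ +-monoʳ-≤ (H * P) (scale-slack (6 + e k) (b*count-A≤place {k} y<P) inv) ⟩
    H * P + (H * P + y)                       ≡⟨ twice H P y ⟩
    2 * H * P + y                             ∎
    where
    open ≤-Reasoning
    H = h k
    P = place k
    regroup : ∀ H b α P M → H * b * α + (H * P + M) ≡ H * P + (H * (b * α) + M)
    regroup = solve-∀
    twice : ∀ H P y → H * P + (H * P + y) ≡ 2 * H * P + y
    twice = solve-∀

  invA-digit-between : ∀ k {c y} → 0 < c → c < h k → y < place k →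
    h k * b k * count A (c * place k + y) + maxA (suc k) ≤ place (suc k) + (c * place k + y)
  invA-digit-between k {suc c} {y} _ c<h y<P = begin
    H * b k * count A x + (H * P + maxA k)
      ≡⟨ cong (λ α → H * b k * α + (H * P + maxA k)) (count-A-between {k} z<s c<h y<P) ⟩
    H * b k * a k + (H * P + maxA k)  ≡⟨ cong (_+ (H * P + maxA k)) (h*b*a≡h*place k) ⟩
    H * P + (H * P + maxA k)          ≤⟨ +-monoʳ-≤ (H * P) (+-monoʳ-≤ (H * P) maxA≤x) ⟩
    H * P + (H * P + x)               ≡⟨ twice H P x ⟩
    2 * H * P + x                     ∎
    where
    open ≤-Reasoning
    H = h k
    P = place k
    x = suc c * P + y
    maxA≤x : maxA k ≤ x
    maxA≤x = ≤-trans (<⇒≤ (maxA<place k)) (≤-trans (m≤m+n P (c * P)) (m≤m+n (suc c * P) y))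
    twice : ∀ H P z → H * P + (H * P + z) ≡ 2 * H * P + z
    twice = solve-∀

  invA-digit-h : ∀ k {y} → y < place k → InvA k y →
    h k * b k * count A (h k * place k + y) + maxA (suc k) ≤ place (suc k) + (h k * place k + y)
  invA-digit-h k {y} y<P inv = begin
    H * b k * count A (H * P + y) + (H * P + maxA k)
      ≡⟨ cong (λ α → H * b k * α + (H * P + maxA k)) (count-A-h {k} y<P) ⟩
    H * b k * (a k + count A y) + (H * P + maxA k)
      ≡⟨ regroup H (b k) (a k) (count A y) P (maxA k) ⟩
    H * b k * a k + H * P + (H * (b k * count A y) + maxA k)
      ≡⟨ cong (λ z → z + H * P + (H * (b k * count A y) + maxA k)) (h*b*a≡h*place k) ⟩
    H * P + H * P + (H * (b k * count A y) + maxA k)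
      ≤⟨ +-monoʳ-≤ (H * P + H * P) (scale-slack (6 + e k) (b*count-A≤place {k} y<P) inv) ⟩
    H * P + H * P + (H * P + y)  ≡⟨ twice H P (H * P + y) ⟩
    2 * H * P + (H * P + y)      ∎
    where
    open ≤-Reasoning
    H = h k
    P = place k
    regroup : ∀ H b a α P M → H * b * (a + α) + (H * P + M) ≡ H * b * a + H * P + (H * (b * α) + M)
    regroup = solve-∀
    twice : ∀ H P z → H * P + H * P + z ≡ 2 * H * P + z
    twice = solve-∀

  invA-digit-above : ∀ k {c y} → h k < c → c < 2 * h k → y < place k →
    h k * b k * count A (c * place k + y) + maxA (suc k) ≤ place (suc k) + (c * place k + y)
  invA-digit-above k {c} {y} h<c c<2h y<P = begin
    H * b k * count A (c * P + y) + (H * P + maxA k)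
      ≡⟨ cong (λ α → H * b k * α + (H * P + maxA k)) (count-A-above {k} h<c c<2h y<P) ⟩
    H * b k * (2 * a k) + (H * P + maxA k)
      ≡⟨ cong (_+ (H * P + maxA k)) (trans (double H (b k) (a k)) (cong (2 *_) (h*b*a≡h*place k))) ⟩
    2 * (H * P) + (H * P + maxA k)  ≤⟨ +-monoʳ-≤ (2 * (H * P)) (≤-trans (<⇒≤ HP+maxA<cP) (m≤m+n (c * P) y)) ⟩
    2 * (H * P) + (c * P + y)       ≡⟨ cong (_+ (c * P + y)) (sym (*-assoc 2 H P)) ⟩
    2 * H * P + (c * P + y)         ∎
    where
    open ≤-Reasoning
    H = h k
    P = place k
    double : ∀ H b a → H * b * (2 * a) ≡ 2 * (H * b * a)
    double = solve-∀
    HP+maxA<cP : H * P + maxA k < c * P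
    HP+maxA<cP = begin-strict
      H * P + maxA k  <⟨ +-monoʳ-< (H * P) (maxA<place k) ⟩
      H * P + P       ≡⟨ +-comm (H * P) P ⟩
      suc H * P       ≤⟨ *-monoˡ-≤ P h<c ⟩
      c * P           ∎

  invA : ∀ k {y} → y < place k → InvA k y
  invA zero    {zero}  _          = ≤-refl
  invA zero    {suc _} (s≤s ())
  invA (suc k) y′<place with digits-view {k} y′<place
  ... | c , y , c<2h , y<P , refl =
    subst (λ β → β * count A x + maxA (suc k) ≤ place (suc k) + x) (sym (b-suc k)) (by-digit c c<2h)
    where
    x = c * place k + y
    by-digit : ∀ c → c < 2 * h k →
      h k * b k * count A (c * place k + y) + maxA (suc k) ≤ place (suc k) + (c * place k + y)
    by-digit zero    _    = invA-digit-0 k y<P (invA k y<P)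
    by-digit (suc c) c<2h with <-cmp (suc c) (h k)
    ... | tri< c<h _ _  = invA-digit-between k z<s c<h y<P
    ... | tri≈ _ refl _ = invA-digit-h k y<P (invA k y<P)
    ... | tri> _ _ h<c  = invA-digit-above k h<c c<2h y<P

  InvB : ℕ → ℕ → Set
  InvB k y = a k * count B y + 2 * maxB k ≤ place k + 2 * y

  invB-digit-below : ∀ k {c y} → c < h k → y < place k → InvB k y →
    2 * a k * count B (c * place k + y) + 2 * maxB (suc k) ≤ place (suc k) + 2 * (c * place k + y)
  invB-digit-below k {c} {y} c<h y<P inv = begin
    2 * a k * count B (c * P + y) + 2 * maxB (suc k)
      ≡⟨ cong (λ β → 2 * a k * β + 2 * maxB (suc k)) (count-B-below {k} c<h y<P) ⟩
    2 * a k * (c * b k + count B y) + 2 * ((6 + e k) * P + maxB k)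
      ≡⟨ regroup (a k) (b k) c (count B y) (6 + e k) P (maxB k) ⟩
    2 * c * (a k * b k) + 2 * (6 + e k) * P + 2 * (a k * count B y + maxB k)
      ≡⟨ cong (λ z → 2 * c * z + 2 * (6 + e k) * P + 2 * (a k * count B y + maxB k)) (a*b≡place k) ⟩
    2 * c * P + 2 * (6 + e k) * P + 2 * (a k * count B y + maxB k)
      ≤⟨ +-monoʳ-≤ (2 * c * P + 2 * (6 + e k) * P) (*-monoʳ-≤ 2 (halve-slack (a*count-B≤place {k} y<P) inv)) ⟩
    2 * c * P + 2 * (6 + e k) * P + 2 * (P + y)
      ≡⟨ collect c (e k) P y ⟩
    2 * h k * P + 2 * (c * P + y) ∎
    where
    open ≤-Reasoning
    P = place k
    regroup : ∀ a b c β g P N →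
      2 * a * (c * b + β) + 2 * (g * P + N) ≡ 2 * c * (a * b) + 2 * g * P + 2 * (a * β + N)
    regroup = solve-∀
    collect : ∀ c e P y → 2 * c * P + 2 * (6 + e) * P + 2 * (P + y) ≡ 2 * (7 + e) * P + 2 * (c * P + y)
    collect = solve-∀

  invB-digit-above : ∀ k {c y} → h k ≤ c → c < 2 * h k → y < place k →
    2 * a k * count B (c * place k + y) + 2 * maxB (suc k) ≤ place (suc k) + 2 * (c * place k + y)
  invB-digit-above k {c} {y} h≤c c<2h y<P = begin
    2 * a k * count B (c * P + y) + 2 * maxB (suc k)
      ≡⟨ cong (λ β → 2 * a k * β + 2 * maxB (suc k)) (count-B-above {k} h≤c c<2h y<P) ⟩
    2 * a k * (h k * b k) + 2 * maxB (suc k)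
      ≡⟨ cong (_+ 2 * maxB (suc k)) (trans (regroup (a k) (b k) (h k)) (cong (2 * h k *_) (a*b≡place k))) ⟩
    2 * h k * P + 2 * maxB (suc k)
      ≤⟨ +-monoʳ-≤ (2 * h k * P) (*-monoʳ-≤ 2 (≤-trans (<⇒≤ maxB<cP) (m≤m+n (c * P) y))) ⟩
    2 * h k * P + 2 * (c * P + y) ∎
    where
    open ≤-Reasoning
    P = place k
    regroup : ∀ a b h → 2 * a * (h * b) ≡ 2 * h * (a * b)
    regroup = solve-∀
    maxB<cP : maxB (suc k) < c * P
    maxB<cP = begin-strict
      (6 + e k) * P + maxB k  <⟨ +-monoʳ-< ((6 + e k) * P) (maxB<place k) ⟩
      (6 + e k) * P + P       ≡⟨ +-comm ((6 + e k) * P) P ⟩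
      h k * P                 ≤⟨ *-monoˡ-≤ P h≤c ⟩
      c * P                   ∎

  invB : ∀ k {y} → y < place k → InvB k y
  invB zero    {zero}  _          = ≤-refl
  invB zero    {suc _} (s≤s ())
  invB (suc k) y′<place with digits-view {k} y′<place
  ... | c , y , c<2h , y<P , refl =
    subst (λ α → α * count B x + 2 * maxB (suc k) ≤ place (suc k) + 2 * x) (sym (a-suc k)) by-digit
    where
    x = c * place k + y
    by-digit : 2 * a k * count B x + 2 * maxB (suc k) ≤ place (suc k) + 2 * x
    by-digit with c <? h k
    ... | yes c<h = invB-digit-below k c<h y<P (invB k y<P)
    ... | no  c≮h = invB-digit-above k (≮⇒≥ c≮h) c<2h y<P

  -- The points of [place k, place (suc k)) where A(x) B(x) / x peaks.
  spikeA spikeB : ℕ → ℕ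
  spikeA k = h k * place k + maxA k
  spikeB k = place k + maxB k

  stage-bound-low-digit : ∀ k {c y} → suc c < h k → y < place k →
    count A (suc c * place k + y) * count B (suc c * place k + y) * spikeB k ≤ 2 * place k * (suc c * place k + y)
  stage-bound-low-digit k {c} {y} c<h y<P = begin
    count A x * count B x * (P + maxB k)
      ≡⟨ cong₂ (λ α β → α * β * (P + maxB k)) (count-A-between {k} z<s c<h y<P) (count-B-below {k} c<h y<P) ⟩
    a k * (suc c * b k + count B y) * (P + maxB k)
      ≡⟨ cong (_* (P + maxB k)) (trans (distrib (a k) (b k) (suc c) (count B y)) (cong (λ z → suc c * z + a k * count B y) (a*b≡place k))) ⟩
    (suc c * P + a k * count B y) * (P + maxB k)
      ≤⟨ product-bound-low-digit c (a*count-B≤place {k} y<P) (<⇒≤ (maxB<place k)) (invB k y<P) ⟩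
    2 * P * x ∎
    where
    open ≤-Reasoning
    P = place k
    x = suc c * P + y
    distrib : ∀ a b c β → a * (c * b + β) ≡ c * (a * b) + a * β
    distrib = solve-∀

  stage-bound-digit-h : ∀ k {y} → y < place k →
    count A (h k * place k + y) * count B (h k * place k + y) * spikeA k ≤ place (suc k) * (h k * place k + y)
  stage-bound-digit-h k {y} y<P = begin
    count A x * count B x * (H * P + maxA k)
      ≡⟨ cong₂ (λ α β → α * β * (H * P + maxA k)) (count-A-h {k} y<P) (count-B-above {k} ≤-refl (h<2h k) y<P) ⟩
    (a k + count A y) * (H * b k) * (H * P + maxA k)
      ≡⟨ cong (_* (H * P + maxA k)) (trans (distrib H (a k) (b k) (count A y)) (cong (λ z → H * (z + b k * count A y)) (a*b≡place k))) ⟩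
    H * (P + b k * count A y) * (H * P + maxA k)
      ≡⟨ *-assoc H (P + b k * count A y) (H * P + maxA k) ⟩
    H * ((P + b k * count A y) * (H * P + maxA k))
      ≤⟨ *-monoʳ-≤ H (product-bound-middle-digit (5 + e k) (b*count-A≤place {k} y<P) (invA k y<P)) ⟩
    H * (2 * P * x)
      ≡⟨ rotate H P x ⟩
    2 * H * P * x ∎
    where
    open ≤-Reasoning
    H = h k
    P = place k
    x = H * P + y
    distrib : ∀ H a b α → (a + α) * (H * b) ≡ H * (a * b + b * α)
    distrib = solve-∀
    rotate : ∀ H P x → H * (2 * P * x) ≡ 2 * H * P * x
    rotate = solve-∀

  stage-bound-high-digit : ∀ k {c y} → h k < c → c < 2 * h k → y < place k →
    count A (c * place k + y) * count B (c * place k + y) * spikeA k ≤ place (suc k) * (c * place k + y)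
  stage-bound-high-digit k {c} {y} h<c c<2h y<P = begin
    count A x * count B x * spikeA k
      ≡⟨ cong₂ (λ α β → α * β * spikeA k) (count-A-above {k} h<c c<2h y<P) (count-B-above {k} (<⇒≤ h<c) c<2h y<P) ⟩
    2 * a k * (H * b k) * spikeA k
      ≡⟨ cong (_* spikeA k) (trans (regroup (a k) (b k) H) (cong (2 * H *_) (a*b≡place k))) ⟩
    place (suc k) * spikeA k
      ≤⟨ *-monoʳ-≤ (place (suc k)) (≤-trans (<⇒≤ spike<cP) (m≤m+n (c * P) y)) ⟩
    place (suc k) * x ∎
    where
    open ≤-Reasoning
    H = h k
    P = place k
    x = c * P + y
    regroup : ∀ a b H → 2 * a * (H * b) ≡ 2 * H * (a * b)
    regroup = solve-∀
    spike<cP : spikeA k < c * P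
    spike<cP = begin-strict
      H * P + maxA k  <⟨ +-monoʳ-< (H * P) (maxA<place k) ⟩
      H * P + P       ≡⟨ +-comm (H * P) P ⟩
      suc H * P       ≤⟨ *-monoˡ-≤ P h<c ⟩
      c * P           ∎

  stage-bound : ∀ k {x} → place k ≤ x → x < place (suc k) →
    count A x * count B x * spikeB k ≤ 2 * place k * x ⊎
    count A x * count B x * spikeA k ≤ place (suc k) * x
  stage-bound k {x} P≤x x<P′ with digits-view {k} x<P′
  ... | zero  , y , _    , y<P , refl = ⊥-elim (<⇒≱ y<P P≤x)
  ... | suc c , y , c<2h , y<P , refl with <-cmp (suc c) (h k)
  ...   | tri< c<h _ _  = inj₁ (stage-bound-low-digit k c<h y<P)
  ...   | tri≈ _ refl _ = inj₂ (stage-bound-digit-h k y<P)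
  ...   | tri> _ _ h<c  = inj₂ (stage-bound-high-digit k h<c c<2h y<P)

  stage-search : ∀ n {K x} → place K ≤ x → x < place (n + K) →
    ∃ λ k → K ≤ k × place k ≤ x × x < place (suc k)
  stage-search zero    P≤x x<P = ⊥-elim (<⇒≱ x<P P≤x)
  stage-search (suc n) {K} {x} P≤x x<P with x <? place (suc K)
  ... | yes x<P′ = K , ≤-refl , P≤x , x<P′
  ... | no  x≮P′ with stage-search n (≮⇒≥ x≮P′) (subst (λ j → x < place j) (sym (+-suc n K)) x<P)
  ...   | k , K<k , Pk≤x , x<Pk′ = k , <⇒≤ K<k , Pk≤x , x<Pk′

  stage-of : ∀ K {x} → place K ≤ x → ∃ λ k → K ≤ k × place k ≤ x × x < place (suc k)
  stage-of K {x} P≤x = stage-search (suc x) P≤x (<-trans (s≤s (m≤m+n x K)) (k<place (suc x + K)))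

  place≤spikeA : ∀ k → place k ≤ spikeA k
  place≤spikeA k = ≤-trans (m≤m+n (place k) _) (m≤m+n (h k * place k) (maxA k))

  eventually-below : ∀ K p s →
    (∀ k → K ≤ k → 2 * place k * s ≤ p * spikeB k × place (suc k) * s ≤ p * spikeA k) →
    Eventually (λ x → s * (count A x * count B x) ≤ p * x)
  eventually-below K p s spikes-below = place K , below
    where
    below : ∀ x → place K ≤ x → s * (count A x * count B x) ≤ p * x
    below x P≤x with stage-of K P≤x
    ... | k , K≤k , Pk≤x , x<Pk′ = subst (_≤ p * x) (*-comm (count A x * count B x) s) (by-spike (stage-bound k Pk≤x x<Pk′))
      where
      f = count A x * count B x
      by-spike : f * spikeB k ≤ 2 * place k * x ⊎ f * spikeA k ≤ place (suc k) * x → f * s ≤ p * x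
      by-spike (inj₁ ≤B) = frac-≤-trans {f} {x} {2 * place k} {spikeB k} {p} {s}
        (≤-trans (place>0 k) (m≤m+n (place k) (maxB k))) ≤B (proj₁ (spikes-below k K≤k))
      by-spike (inj₂ ≤A) = frac-≤-trans {f} {x} {place (suc k)} {spikeA k} {p} {s}
        (≤-trans (place>0 k) (place≤spikeA k)) ≤A (proj₂ (spikes-below k K≤k))

  spike-product : ∀ k → count A (spikeA k) * count B (spikeA k) ≡ place (suc k)
  spike-product k = begin
    count A (spikeA k) * count B (spikeA k)
      ≡⟨ cong₂ _*_ (count-A-h {k} (maxA<place k)) (count-B-above {k} ≤-refl (h<2h k) (maxA<place k)) ⟩
    (a k + count A (maxA k)) * (h k * b k)
      ≡⟨ cong (λ α → (a k + α) * (h k * b k)) (count-A-maxA k) ⟩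
    (a k + a k) * (h k * b k)
      ≡⟨ regroup (a k) (b k) (h k) ⟩
    2 * h k * (a k * b k)
      ≡⟨ cong (2 * h k *_) (a*b≡place k) ⟩
    place (suc k) ∎
    where
    open ≡-Reasoning
    regroup : ∀ a b h → (a + a) * (h * b) ≡ 2 * h * (a * b)
    regroup = solve-∀

  often-above : ∀ p s → (∀ n → ∃ λ k → n ≤ k × p * spikeA k ≤ s * place (suc k)) →
    InfinitelyOften (λ x → 1 ≤ x × p * x ≤ s * (count A x * count B x))
  often-above p s spikes-above n with spikes-above n
  ... | k , n≤k , above = spikeA k , n≤spike , ≤-trans (place>0 k) (place≤spikeA k) ,
                          subst (λ z → p * spikeA k ≤ s * z) (sym (spike-product k)) above
    where n≤spike = ≤-trans n≤k (≤-trans (<⇒≤ (k<place k)) (place≤spikeA k))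

  digit-split : ∀ k {c} → c < 2 * h k →
    ∃ λ α → ∃ λ β → zeroOrH k α ≡ true × belowH k β ≡ true × α + β ≡ c
  digit-split k {c} c<2h with c <? h k
  ... | yes c<h = 0 , c , refl , <⇒<ᵇ-true c<h , refl
  ... | no  c≮h = h k , c ∸ h k , ≡ᵇ-refl (h k) ,
                  <⇒<ᵇ-true (subst (c ∸ h k <_) (+-identityʳ (h k)) (m<n+o⇒m∸n<o c (h k) c<2h)) ,
                  m+[n∸m]≡n (≮⇒≥ c≮h)

  A+B⊇below-place : ∀ k {n} → n < place k → ∃ λ u → ∃ λ v → u ∈ₛ A × v ∈ₛ B × u + v ≡ n
  A+B⊇below-place zero    {zero}  _        = 0 , 0 , refl , refl , refl
  A+B⊇below-place zero    {suc _} (s≤s ())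
  A+B⊇below-place (suc k) n<P′ with digits-view {k} n<P′
  ... | c , y , c<2h , y<P , refl with A+B⊇below-place k y<P | digit-split k c<2h
  ...   | u , v , u∈A , v∈B , u+v≡y | α , β , α-allowed , β-allowed , α+β≡c =
    α * P + u , β * P + v ,
    trans (𝒜.digitSet-digits α<2h u<P) (cong₂ _∧_ α-allowed u∈A) ,
    trans (ℬ.digitSet-digits β<2h v<P) (cong₂ _∧_ β-allowed v∈B) ,
    (begin
      α * P + u + (β * P + v) ≡⟨ regroup α β P u v ⟩
      (α + β) * P + (u + v)   ≡⟨ cong₂ (λ d r → d * P + r) α+β≡c u+v≡y ⟩
      c * P + y               ∎)
    where
    open ≡-Reasoning
    P = place k
    α<2h = ≤-<-trans (≤-trans (m≤m+n α β) (≤-reflexive α+β≡c)) c<2h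
    β<2h = ≤-<-trans (≤-trans (m≤n+m β α) (≤-reflexive α+β≡c)) c<2h
    u<P = ≤-<-trans (≤-trans (m≤m+n u v) (≤-reflexive u+v≡y)) y<P
    v<P = ≤-<-trans (≤-trans (m≤n+m v u) (≤-reflexive u+v≡y)) y<P
    regroup : ∀ α β P u v → α * P + u + (β * P + v) ≡ (α + β) * P + (u + v)
    regroup = solve-∀

  additive-complements : AdditiveComplements A B
  additive-complements = A-infinite , B-infinite , (0 , λ n _ → A+B⊇below-place n (k<place n))
    where
    n≤digit-at-n : ∀ n d m → n ≤ suc d * place n + m
    n≤digit-at-n n d m = ≤-trans (<⇒≤ (k<place n)) (≤-trans (m≤m+n (place n) (d * place n)) (m≤m+n _ m))
    A-infinite : Infinite A
    A-infinite n = h n * place n + 0 , n≤digit-at-n n (6 + e n) 0 ,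
      trans (𝒜.digitSet-digits {n} (h<2h n) (place>0 n)) (cong (_∧ true) (≡ᵇ-refl (h n)))
    B-infinite : Infinite B
    B-infinite n = 1 * place n + 0 , n≤digit-at-n n 0 0 , ℬ.digitSet-digits {n} (s≤s (s≤s z≤n)) (place>0 n)

  count-product-at-pred-place : ∀ k → count A (pred (place k)) * count B (pred (place k)) ≡ pred (place k) + 1
  count-product-at-pred-place k = begin
    count A (pred P) * count B (pred P)
      ≡⟨ cong₂ _*_ (count≡countBelow A (pred P)) (count≡countBelow B (pred P)) ⟩
    countBelow A (suc (pred P)) * countBelow B (suc (pred P))
      ≡⟨ cong (λ m → countBelow A m * countBelow B m) suc-pred-P ⟩
    a k * b k
      ≡⟨ a*b≡place k ⟩
    P
      ≡⟨ sym suc-pred-P ⟩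
    suc (pred P)
      ≡⟨ +-comm 1 (pred P) ⟩
    pred P + 1 ∎
    where
    open ≡-Reasoning
    P = place k
    suc-pred-P : suc (pred P) ≡ P
    suc-pred-P = suc-pred P ⦃ place-nonZero k ⦄

  product≡x+1-often : InfinitelyOften (λ x → 1 ≤ x × count A x * count B x ≡ x + 1)
  product≡x+1-often n = pred (place (suc n)) , ≤-trans (n≤1+n n) 1+n≤x , ≤-trans (s≤s z≤n) 1+n≤x ,
                        count-product-at-pred-place (suc n)
    where 1+n≤x = <⇒≤pred (k<place (suc n))

  place≤2*maxA : ∀ k → 1 ≤ k → place k ≤ 2 * maxA k
  place≤2*maxA (suc k) _ = begin
    2 * h k * place k        ≡⟨ *-assoc 2 (h k) (place k) ⟩
    2 * (h k * place k)      ≤⟨ *-monoʳ-≤ 2 (m≤m+n (h k * place k) (maxA k)) ⟩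
    2 * maxA (suc k)         ∎
    where open ≤-Reasoning

  spikeA≤ : ∀ k → spikeA k ≤ suc (h k) * place k
  spikeA≤ k = begin
    h k * place k + maxA k   ≤⟨ +-monoʳ-≤ (h k * place k) (<⇒≤ (maxA<place k)) ⟩
    h k * place k + place k  ≡⟨ +-comm (h k * place k) (place k) ⟩
    suc (h k) * place k      ∎
    where open ≤-Reasoning

  -- Since maxA k ≥ place k / 2, the A-spike ratio place (suc k) / spikeA k is at most 4h/(2h+1).
  spikeA-ratio≤ : ∀ k {j} → 1 ≤ k → e k ≤ j → place (suc k) * suc (2 * (7 + j)) ≤ 4 * (7 + j) * spikeA k
  spikeA-ratio≤ k {j} 1≤k e≤j = begin
    2 * h k * P * suc (2 * H)           ≡⟨ expand (h k) H P ⟩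
    4 * H * (h k * P) + 2 * h k * P     ≤⟨ +-monoʳ-≤ (4 * H * (h k * P)) (*-mono-≤ (*-monoʳ-≤ 2 (+-monoʳ-≤ 7 e≤j)) (place≤2*maxA k 1≤k)) ⟩
    4 * H * (h k * P) + 2 * H * (2 * maxA k) ≡⟨ collect H (h k * P) (maxA k) ⟩
    4 * H * spikeA k                    ∎
    where
    open ≤-Reasoning
    H = 7 + j
    P = place k
    expand : ∀ h H P → 2 * h * P * suc (2 * H) ≡ 4 * H * (h * P) + 2 * h * P
    expand = solve-∀
    collect : ∀ H x m → 4 * H * x + 2 * H * (2 * m) ≡ 4 * H * (x + m)
    collect = solve-∀

  spikeB-ratio≤7/5 : ∀ k → 2 * place (suc k) * 5 ≤ 7 * spikeB (suc k)
  spikeB-ratio≤7/5 k = ≤-trans (m≤m+n _ (e k * place k + 7 * maxB k)) (≤-reflexive (collect (e k) (place k) (maxB k)))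
    where
    collect : ∀ x t m → 2 * (2 * (7 + x) * t) * 5 + (x * t + 7 * m) ≡ 7 * (2 * (7 + x) * t + ((6 + x) * t + m))
    collect = solve-∀

  limsup>16/9 : (∀ n → ∃ λ k → n ≤ k × e k ≡ 2) → LimsupGt A B 16 8
  limsup>16/9 often-2 = 9 , 4 , ≤-refl , often-above 9 5 spike≥9/5
    where
    spike≥9/5 : ∀ n → ∃ λ k → n ≤ k × 9 * spikeA k ≤ 5 * place (suc k)
    spike≥9/5 n with often-2 n
    ... | k , n≤k , e≡2 = k , n≤k , (begin
      9 * spikeA k                ≤⟨ *-monoʳ-≤ 9 (spikeA≤ k) ⟩
      9 * (suc (h k) * place k)   ≡⟨ cong (λ x → 9 * (suc (7 + x) * place k)) e≡2 ⟩
      9 * (10 * place k)          ≡⟨ ninety (place k) ⟩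
      5 * (2 * 9 * place k)       ≡⟨ cong (λ x → 5 * (2 * (7 + x) * place k)) (sym e≡2) ⟩
      5 * place (suc k)           ∎)
      where
      open ≤-Reasoning
      ninety : ∀ P → 9 * (10 * P) ≡ 5 * (2 * 9 * P)
      ninety = solve-∀

  limsup<2 : (∀ k → e k ≤ 2) → LimsupLt A B 2 0
  limsup<2 e≤2 = 36 , 18 , n≤1+n 37 , eventually-below 1 36 19 spikes≤36/19
    where
    spikes≤36/19 : ∀ k → 1 ≤ k → 2 * place k * 19 ≤ 36 * spikeB k × place (suc k) * 19 ≤ 36 * spikeA k
    spikes≤36/19 (suc k) 1≤k =
      frac-≤-trans {2 * place (suc k)} {spikeB (suc k)} {7} {5} {36} {19} z<s (spikeB-ratio≤7/5 k) (≤ᵇ⇒≤ (7 * 19) (36 * 5) _) ,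
      spikeA-ratio≤ (suc k) 1≤k (e≤2 (suc k))

  Run : ℕ → List ℕ → Set
  Run S L = ∀ i → i < length L → e (S + i) ≡ nth L i

  run-head : ∀ {S x L} → Run S (x ∷ L) → e S ≡ x
  run-head {S} run = trans (cong e (sym (+-identityʳ S))) (run 0 z<s)

  run-tail : ∀ {S x L} → Run S (x ∷ L) → Run (suc S) L
  run-tail {S} run i i<len = trans (cong e (sym (+-suc S i))) (run (suc i) (s≤s i<len))

  place-run : ∀ S L → Run S L → place (S + length L) ≡ wordPlace L * place S
  place-run S []      _   = trans (cong place (+-identityʳ S)) (sym (*-identityˡ (place S)))
  place-run S (x ∷ L) run = begin
    place (S + suc (length L))              ≡⟨ cong place (+-suc S (length L)) ⟩
    place (suc S + length L)                ≡⟨ place-run (suc S) L (run-tail run) ⟩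
    wordPlace L * (2 * h S * place S)       ≡⟨ cong (λ z → wordPlace L * (2 * (7 + z) * place S)) (run-head run) ⟩
    wordPlace L * (2 * (7 + x) * place S)   ≡⟨ sym (*-assoc (wordPlace L) (2 * (7 + x)) (place S)) ⟩
    wordPlace L * (2 * (7 + x)) * place S   ∎
    where open ≡-Reasoning

  maxA-run : ∀ S L → Run S L → maxA (S + length L) ≡ wordMax L * place S + maxA S
  maxA-run S []      _   = cong maxA (+-identityʳ S)
  maxA-run S (x ∷ L) run = begin
    maxA (S + suc (length L))
      ≡⟨ cong maxA (+-suc S (length L)) ⟩
    maxA (suc S + length L)
      ≡⟨ maxA-run (suc S) L (run-tail run) ⟩
    wordMax L * (2 * h S * place S) + (h S * place S + maxA S)
      ≡⟨ cong (λ z → wordMax L * (2 * (7 + z) * place S) + ((7 + z) * place S + maxA S)) (run-head run) ⟩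
    wordMax L * (2 * (7 + x) * place S) + ((7 + x) * place S + maxA S)
      ≡⟨ regroup (wordMax L) x (place S) (maxA S) ⟩
    (wordMax L * (2 * (7 + x)) + (7 + x)) * place S + maxA S ∎
    where
    open ≡-Reasoning
    regroup : ∀ w x t m → w * (2 * (7 + x) * t) + ((7 + x) * t + m) ≡ (w * (2 * (7 + x)) + (7 + x)) * t + m
    regroup = solve-∀

  maxA/place≤run-upper : ∀ S L → Run S L →
    maxA (S + length L) * wordPlace L ≤ (wordMax L + 1) * place (S + length L)
  maxA/place≤run-upper S L run rewrite place-run S L run | maxA-run S L run = begin
    (wordMax L * place S + maxA S) * wordPlace L       ≡⟨ expand (wordMax L) (wordPlace L) (place S) (maxA S) ⟩
    wordMax L * place S * wordPlace L + maxA S * wordPlace L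
      ≤⟨ +-monoʳ-≤ (wordMax L * place S * wordPlace L) (*-monoˡ-≤ (wordPlace L) (<⇒≤ (maxA<place S))) ⟩
    wordMax L * place S * wordPlace L + place S * wordPlace L ≡⟨ collect (wordMax L) (wordPlace L) (place S) ⟩
    (wordMax L + 1) * (wordPlace L * place S)          ∎
    where
    open ≤-Reasoning
    expand : ∀ A P t m → (A * t + m) * P ≡ A * t * P + m * P
    expand = solve-∀
    collect : ∀ A P t → A * t * P + t * P ≡ (A + 1) * (P * t)
    collect = solve-∀

  run-lower≤maxA/place : ∀ S L → 1 ≤ S → Run S L →
    (2 * wordMax L + 1) * place (S + length L) ≤ 2 * maxA (S + length L) * wordPlace L
  run-lower≤maxA/place S L 1≤S run rewrite place-run S L run | maxA-run S L run = begin
    (2 * wordMax L + 1) * (wordPlace L * place S)       ≡⟨ expand (wordMax L) (wordPlace L) (place S) ⟩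
    2 * wordMax L * place S * wordPlace L + place S * wordPlace L
      ≤⟨ +-monoʳ-≤ (2 * wordMax L * place S * wordPlace L) (*-monoˡ-≤ (wordPlace L) (place≤2*maxA S 1≤S)) ⟩
    2 * wordMax L * place S * wordPlace L + 2 * maxA S * wordPlace L ≡⟨ collect (wordMax L) (wordPlace L) (place S) (maxA S) ⟩
    2 * (wordMax L * place S + maxA S) * wordPlace L    ∎
    where
    open ≤-Reasoning
    expand : ∀ A P t → (2 * A + 1) * (P * t) ≡ 2 * A * t * P + t * P
    expand = solve-∀
    collect : ∀ A P t m → 2 * A * t * P + 2 * m * P ≡ 2 * (A * t + m) * P
    collect = solve-∀

-- The digit sequence

segment : ℕ → List ℕ
segment g = 0 ∷ replicate g 1

word : ℕ → List ℕ
word zero    = []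
word (suc j) = segment j ++ word j

block : ℕ → List ℕ
block j = word (suc j) ++ [ 2 ]

prefix : ℕ → List ℕ
prefix zero    = []
prefix (suc j) = prefix j ++ block j

digitSeq : ℕ → ℕ
digitSeq k = nth (prefix (suc k)) k

word≤1 : ∀ j → All (_≤ 1) (word j)
word≤1 zero    = []
word≤1 (suc j) = ++⁺ (z≤n ∷ replicate⁺ j ≤-refl) (word≤1 j)

prefix≤2 : ∀ j → All (_≤ 2) (prefix j)
prefix≤2 zero    = []
prefix≤2 (suc j) = ++⁺ (prefix≤2 j) (++⁺ (All.map (λ x≤1 → m≤n⇒m≤1+n x≤1) (word≤1 (suc j))) (≤-refl ∷ []))

digitSeq≤2 : ∀ k → digitSeq k ≤ 2
digitSeq≤2 k = nth-≤ (prefix (suc k)) k (s≤s z≤n) (prefix≤2 (suc k))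

blockStart twoAt : ℕ → ℕ
blockStart j = length (prefix j)
twoAt j = blockStart j + length (word (suc j))

blockStart-suc : ∀ j → blockStart (suc j) ≡ suc (twoAt j)
blockStart-suc j = begin
  length (prefix j ++ block j)               ≡⟨ length-++ (prefix j) ⟩
  blockStart j + length (word (suc j) ++ [ 2 ]) ≡⟨ cong (blockStart j +_) (length-++ (word (suc j))) ⟩
  blockStart j + (length (word (suc j)) + 1) ≡⟨ cong (blockStart j +_) (+-comm _ 1) ⟩
  blockStart j + suc (length (word (suc j))) ≡⟨ +-suc (blockStart j) _ ⟩
  suc (twoAt j)                              ∎
  where open ≡-Reasoning

j≤blockStart : ∀ j → j ≤ blockStart j
j≤blockStart zero    = z≤n
j≤blockStart (suc j) = subst (suc j ≤_) (sym (blockStart-suc j)) (s≤s (≤-trans (j≤blockStart j) (m≤m+n _ _)))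

j≤twoAt : ∀ j → j ≤ twoAt j
j≤twoAt j = ≤-trans (j≤blockStart j) (m≤m+n (blockStart j) _)

twoAt-<-suc : ∀ j → twoAt j < twoAt (suc j)
twoAt-<-suc j = ≤-trans (≤-reflexive (sym (blockStart-suc j))) (m≤m+n (blockStart (suc j)) _)

twoAt-strictMono : ∀ {j j′} → j < j′ → twoAt j < twoAt j′
twoAt-strictMono = go ∘ ≤⇒≤′
  where
  go : ∀ {j j′} → suc j ≤′ j′ → twoAt j < twoAt j′
  go {j} ≤′-refl                  = twoAt-<-suc j
  go     (≤′-step {j′} sj≤′j′) = <-trans (go sj≤′j′) (twoAt-<-suc j′)

twoAt-cancel-≤ : ∀ {j j′} → twoAt j ≤ twoAt j′ → j ≤ j′
twoAt-cancel-≤ twoAt≤ = ≮⇒≥ (λ j′<j → <⇒≱ (twoAt-strictMono j′<j) twoAt≤)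

prefix-extends : ∀ {j j′} → j ≤ j′ → ∃ λ zs → prefix j′ ≡ prefix j ++ zs
prefix-extends = go ∘ ≤⇒≤′
  where
  go : ∀ {j j′} → j ≤′ j′ → ∃ λ zs → prefix j′ ≡ prefix j ++ zs
  go {j} ≤′-refl = [] , sym (++-identityʳ (prefix j))
  go {j} (≤′-step {j′} j≤′j′) with go j≤′j′
  ... | zs , eq = zs ++ block j′ , trans (cong (_++ block j′) eq) (++-assoc (prefix j) zs (block j′))

digitSeq-block : ∀ j {i} → i < length (block j) → digitSeq (blockStart j + i) ≡ nth (block j) i
digitSeq-block j {i} i<len with prefix-extends {suc j} {suc k} (s≤s j≤k)
  where k = blockStart j + i
        j≤k = ≤-trans (j≤blockStart j) (m≤m+n (blockStart j) i)
... | zs , eq = begin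
  nth (prefix (suc k)) k          ≡⟨ cong (λ l → nth l k) eq ⟩
  nth (prefix (suc j) ++ zs) k    ≡⟨ nth-++ˡ (prefix (suc j)) zs k<len ⟩
  nth (prefix j ++ block j) k     ≡⟨ nth-++ʳ (prefix j) (block j) i ⟩
  nth (block j) i                 ∎
  where
  open ≡-Reasoning
  k = blockStart j + i
  k<len : k < length (prefix (suc j))
  k<len = <-≤-trans (+-monoʳ-< (blockStart j) i<len) (≤-reflexive (sym (length-++ (prefix j))))

digitSeq-word : ∀ j {i} → i < length (word (suc j)) → digitSeq (blockStart j + i) ≡ nth (word (suc j)) i
digitSeq-word j {i} i<len = trans (digitSeq-block j i<len′) (nth-++ˡ (word (suc j)) [ 2 ] i<len)
  where i<len′ = <-≤-trans i<len (≤-trans (m≤m+n _ 1) (≤-reflexive (sym (length-++ (word (suc j))))))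

digitSeq-twoAt : ∀ j → digitSeq (twoAt j) ≡ 2
digitSeq-twoAt j = begin
  digitSeq (blockStart j + length w)  ≡⟨ digitSeq-block j (≤-reflexive (sym len-block)) ⟩
  nth (w ++ [ 2 ]) (length w)         ≡⟨ cong (nth (w ++ [ 2 ])) (sym (+-identityʳ (length w))) ⟩
  nth (w ++ [ 2 ]) (length w + 0)     ≡⟨ nth-++ʳ w [ 2 ] 0 ⟩
  2                                   ∎
  where
  open ≡-Reasoning
  w = word (suc j)
  len-block : length (block j) ≡ suc (length w)
  len-block = trans (length-++ w) (+-comm (length w) 1)

two-in-prefix : ∀ j i → nth (prefix j) i ≡ 2 → ∃ λ j′ → i ≡ twoAt j′
two-in-prefix zero    i ()
two-in-prefix (suc j) i is-2 with nth-++ (prefix j) (block j) i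
... | inj₁ (_ , in-prefix) = two-in-prefix j i (trans (sym in-prefix) is-2)
... | inj₂ (i′ , refl , in-block) with nth-++ (word (suc j)) [ 2 ] i′
...   | inj₁ (_ , in-word) =
  ⊥-elim (<⇒≱ (s≤s ≤-refl) (subst (_≤ 1) (trans (sym in-word) (trans (sym in-block) is-2))
                                          (nth-≤ (word (suc j)) i′ ≤-refl (word≤1 (suc j)))))
...   | inj₂ (zero , refl , _) = j , cong (blockStart j +_) (+-identityʳ _)
...   | inj₂ (suc i″ , refl , past-end) with trans (sym past-end) (trans (sym in-block) is-2)
...     | ()

digitSeq≡2⇒twoAt : ∀ k → digitSeq k ≡ 2 → ∃ λ j → k ≡ twoAt j
digitSeq≡2⇒twoAt k = two-in-prefix (suc k) k

wordPlace-++ : ∀ L₁ L₂ → wordPlace (L₁ ++ L₂) ≡ wordPlace L₂ * wordPlace L₁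
wordPlace-++ []       L₂ = sym (*-identityʳ (wordPlace L₂))
wordPlace-++ (x ∷ L₁) L₂ = trans (cong (_* (2 * (7 + x))) (wordPlace-++ L₁ L₂)) (*-assoc (wordPlace L₂) _ _)

wordMax-++ : ∀ L₁ L₂ → wordMax (L₁ ++ L₂) ≡ wordMax L₂ * wordPlace L₁ + wordMax L₁
wordMax-++ []       L₂ = sym (trans (+-identityʳ _) (*-identityʳ (wordMax L₂)))
wordMax-++ (x ∷ L₁) L₂ =
  trans (cong (λ z → z * (2 * (7 + x)) + (7 + x)) (wordMax-++ L₁ L₂)) (regroup (wordMax L₂) (wordPlace L₁) (wordMax L₁) x)
  where
  regroup : ∀ a p b x → (a * p + b) * (2 * (7 + x)) + (7 + x) ≡ a * (p * (2 * (7 + x))) + (b * (2 * (7 + x)) + (7 + x))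
  regroup = solve-∀

wordPlace>0 : ∀ L → 0 < wordPlace L
wordPlace>0 []      = z<s
wordPlace>0 (x ∷ L) = *-mono-≤ (wordPlace>0 L) (s≤s z≤n)

ones-max : ∀ g → 15 * wordMax (replicate g 1) + 8 ≡ 8 * wordPlace (replicate g 1)
ones-max zero    = refl
ones-max (suc g) = trans (regroup (wordMax (replicate g 1))) (trans (cong (16 *_) (ones-max g)) (rotate (wordPlace (replicate g 1))))
  where
  regroup : ∀ m → 15 * (m * 16 + 8) + 8 ≡ 16 * (15 * m + 8)
  regroup = solve-∀
  rotate : ∀ p → 16 * (8 * p) ≡ 8 * (p * 16)
  rotate = solve-∀

ones-place≥ : ∀ g → suc g ≤ wordPlace (replicate g 1)
ones-place≥ zero    = s≤s z≤n
ones-place≥ (suc g) = begin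
  suc (suc g)  ≤⟨ s≤s (ones-place≥ g) ⟩
  suc w        ≤⟨ +-monoˡ-≤ w (wordPlace>0 (replicate g 1)) ⟩
  w + w        ≡⟨ cong (w +_) (sym (+-identityʳ w)) ⟩
  2 * w        ≡⟨ *-comm 2 w ⟩
  w * 2        ≤⟨ *-monoʳ-≤ w (s≤s (s≤s z≤n)) ⟩
  w * 16       ∎
  where
  open ≤-Reasoning
  w = wordPlace (replicate g 1)

segment-upper : ∀ g → 15 * (wordMax (segment g) + 1) ≡ 8 * wordPlace (segment g) + 8
segment-upper g = trans (regroup (wordMax (replicate g 1))) (trans (cong (λ z → 14 * z + 8) (ones-max g)) (rotate (wordPlace (replicate g 1))))
  where
  regroup : ∀ m → 15 * (m * 14 + 7 + 1) ≡ 14 * (15 * m + 8) + 8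
  regroup = solve-∀
  rotate : ∀ p → 14 * (8 * p) + 8 ≡ 8 * (p * 14) + 8
  rotate = solve-∀

segment-lower : ∀ g → 15 * (2 * wordMax (segment g) + 1) ≡ 16 * wordPlace (segment g) + 1
segment-lower g = trans (regroup (wordMax (replicate g 1))) (trans (cong (λ z → 28 * z + 1) (ones-max g)) (rotate (wordPlace (replicate g 1))))
  where
  regroup : ∀ m → 15 * (2 * (m * 14 + 7) + 1) ≡ 28 * (15 * m + 8) + 1
  regroup = solve-∀
  rotate : ∀ p → 28 * (8 * p) + 1 ≡ 16 * (p * 14) + 1
  rotate = solve-∀

segment-place≥ : ∀ g → 14 * suc g ≤ wordPlace (segment g)
segment-place≥ g = ≤-trans (*-monoʳ-≤ 14 (ones-place≥ g)) (≤-reflexive (*-comm 14 (wordPlace (replicate g 1))))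

segment-max+1<place : ∀ g → wordMax (segment g) + 1 < wordPlace (segment g)
segment-max+1<place g = *-cancelˡ-< 15 _ _ (begin-strict
  15 * (wordMax (segment g) + 1) ≡⟨ segment-upper g ⟩
  8 * q + 8                      <⟨ +-monoʳ-< (8 * q) (≤-trans (≤ᵇ⇒≤ 9 14 _) (≤-trans (m≤m*n 14 (suc g)) (segment-place≥ g))) ⟩
  8 * q + q                      ≤⟨ +-monoʳ-≤ (8 * q) (m≤n*m q 7) ⟩
  8 * q + 7 * q                  ≡⟨ sym (*-distribʳ-+ q 8 7) ⟩
  15 * q                         ∎)
  where
  open ≤-Reasoning
  q = wordPlace (segment g)

segment-place<2max+1 : ∀ g → wordPlace (segment g) < 2 * wordMax (segment g) + 1
segment-place<2max+1 g = *-cancelˡ-< 15 _ _ (begin-strict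
  15 * q                             ≤⟨ *-monoˡ-≤ q (n≤1+n 15) ⟩
  16 * q                             <⟨ m<m+n (16 * q) z<s ⟩
  16 * q + 1                         ≡⟨ sym (segment-lower g) ⟩
  15 * (2 * wordMax (segment g) + 1) ∎)
  where
  open ≤-Reasoning
  q = wordPlace (segment g)

upper-step : ∀ {A P a q} → 0 < P → a + 1 < q → (A * q + a + 1) * P < (A + 1) * (P * q)
upper-step {A} {P} {a} {q} P>0 a+1<q = begin-strict
  (A * q + a + 1) * P      ≡⟨ expand A q a P ⟩
  A * q * P + (a + 1) * P  <⟨ +-monoʳ-< (A * q * P) (*-monoˡ-< P ⦃ >-nonZero P>0 ⦄ a+1<q) ⟩
  A * q * P + q * P        ≡⟨ collect A q P ⟩
  (A + 1) * (P * q)        ∎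
  where
  open ≤-Reasoning
  expand : ∀ A q a P → (A * q + a + 1) * P ≡ A * q * P + (a + 1) * P
  expand = solve-∀
  collect : ∀ A q P → A * q * P + q * P ≡ (A + 1) * (P * q)
  collect = solve-∀

lower-step : ∀ {A P a q} → 0 < P → q < 2 * a + 1 → (2 * A + 1) * (P * q) < (2 * (A * q + a) + 1) * P
lower-step {A} {P} {a} {q} P>0 q<2a+1 = begin-strict
  (2 * A + 1) * (P * q)           ≡⟨ expand A q P ⟩
  2 * A * q * P + q * P           <⟨ +-monoʳ-< (2 * A * q * P) (*-monoˡ-< P ⦃ >-nonZero P>0 ⦄ q<2a+1) ⟩
  2 * A * q * P + (2 * a + 1) * P ≡⟨ collect A q a P ⟩
  (2 * (A * q + a) + 1) * P       ∎
  where
  open ≤-Reasoning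
  expand : ∀ A q P → (2 * A + 1) * (P * q) ≡ 2 * A * q * P + q * P
  expand = solve-∀
  collect : ∀ A q a P → 2 * A * q * P + (2 * a + 1) * P ≡ (2 * (A * q + a) + 1) * P
  collect = solve-∀

-- r_j⁺ = (wmax j + 1) / wplace j and r_j⁻ = (2 wmax j + 1) / (2 wplace j).
wmax wplace : ℕ → ℕ
wmax   j = wordMax (word (suc j))
wplace j = wordPlace (word (suc j))

wplace>0 : ∀ j → 0 < wplace j
wplace>0 j = wordPlace>0 (word (suc j))

upper-decreasing : ∀ j → (wmax (suc j) + 1) * wplace j < (wmax j + 1) * wplace (suc j)
upper-decreasing j =
  subst₂ (λ A P → (A + 1) * wplace j < (wmax j + 1) * P)
    (sym (wordMax-++ (segment (suc j)) (word (suc j)))) (sym (wordPlace-++ (segment (suc j)) (word (suc j))))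
    (upper-step {wmax j} {wplace j} {wordMax (segment (suc j))} {wordPlace (segment (suc j))} (wplace>0 j) (segment-max+1<place (suc j)))

lower-increasing : ∀ j → (2 * wmax j + 1) * wplace (suc j) < (2 * wmax (suc j) + 1) * wplace j
lower-increasing j =
  subst₂ (λ A P → (2 * wmax j + 1) * P < (2 * A + 1) * wplace j)
    (sym (wordMax-++ (segment (suc j)) (word (suc j)))) (sym (wordPlace-++ (segment (suc j)) (word (suc j))))
    (lower-step {wmax j} {wplace j} {wordMax (segment (suc j))} {wordPlace (segment (suc j))} (wplace>0 j) (segment-place<2max+1 (suc j)))

upper-antitone : ∀ j d → (wmax (d + j) + 1) * wplace j ≤ (wmax j + 1) * wplace (d + j)
upper-antitone j zero    = ≤-refl
upper-antitone j (suc d) =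
  frac-≤-trans {wmax (suc d + j) + 1} {wplace (suc d + j)} {wmax (d + j) + 1} {wplace (d + j)} {wmax j + 1} {wplace j}
    (wplace>0 (d + j)) (<⇒≤ (upper-decreasing (d + j))) (upper-antitone j d)

lower-monotone : ∀ j d → (2 * wmax j + 1) * wplace (d + j) ≤ (2 * wmax (d + j) + 1) * wplace j
lower-monotone j zero    = ≤-refl
lower-monotone j (suc d) =
  frac-≤-trans {2 * wmax j + 1} {wplace j} {2 * wmax (d + j) + 1} {wplace (d + j)} {2 * wmax (suc d + j) + 1} {wplace (suc d + j)}
    (wplace>0 (d + j)) (lower-monotone j d) (<⇒≤ (lower-increasing (d + j)))

upper-at-1 : (wmax 1 + 1) * 16 ≤ 9 * wplace 1
upper-at-1 = ≤ᵇ⇒≤ ((wmax 1 + 1) * 16) (9 * wplace 1) _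

-- 15 W > 8 p puts W / p at least 1 / (15 p) above 8/15, while the window lies within 8 / (15 q) of it.
fraction-window : ∀ {a q p W} → 15 * (a + 1) ≡ 8 * q + 8 → 15 * (2 * a + 1) ≡ 16 * q + 1 →
  p * (2 * a + 1) < 2 * q * W → q * W < p * (a + 1) → q < 8 * p
fraction-window {a} {q} {p} {W} upper lower p[2a+1]<2qW qW<p[a+1] =
  +-cancelˡ-< (q * (8 * p)) q (8 * p) (begin-strict
    q * (8 * p) + q       ≡⟨ trans (+-comm (q * (8 * p)) q) (sym (*-suc q (8 * p))) ⟩
    q * suc (8 * p)       ≤⟨ *-monoʳ-≤ q 8p<15W ⟩
    q * (15 * W)          ≡⟨ pull-15 q W ⟩
    15 * (q * W)          <⟨ *-monoʳ-< 15 qW<p[a+1] ⟩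
    15 * (p * (a + 1))    ≡⟨ sym (pull-15 p (a + 1)) ⟩
    p * (15 * (a + 1))    ≡⟨ cong (p *_) upper ⟩
    p * (8 * q + 8)       ≡⟨ expand p q ⟩
    q * (8 * p) + 8 * p   ∎)
  where
  open ≤-Reasoning
  pull-15 : ∀ x y → x * (15 * y) ≡ 15 * (x * y)
  pull-15 = solve-∀
  expand : ∀ p q → p * (8 * q + 8) ≡ q * (8 * p) + 8 * p
  expand = solve-∀
  8p<15W : 8 * p < 15 * W
  8p<15W = *-cancelˡ-< (2 * q) _ _ (begin-strict
    2 * q * (8 * p)          ≤⟨ ≤-trans (≤-reflexive (regroup q p)) (m≤m+n (16 * q * p) p) ⟩
    16 * q * p + p           ≡⟨ factor q p ⟩
    p * (16 * q + 1)         ≡⟨ cong (p *_) (sym lower) ⟩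
    p * (15 * (2 * a + 1))   ≡⟨ pull-15 p (2 * a + 1) ⟩
    15 * (p * (2 * a + 1))   <⟨ *-monoʳ-< 15 p[2a+1]<2qW ⟩
    15 * (2 * q * W)         ≡⟨ rotate q W ⟩
    2 * q * (15 * W)         ∎)
    where
    regroup : ∀ q p → 2 * q * (8 * p) ≡ 16 * q * p
    regroup = solve-∀
    factor : ∀ q p → 16 * q * p + p ≡ p * (16 * q + 1)
    factor = solve-∀
    rotate : ∀ q W → 15 * (2 * q * W) ≡ 2 * q * (15 * W)
    rotate = solve-∀

gap-numerator : ∀ {p u A₀ P₀ a q} →
  18 * (P₀ * q) * u < p * suc (9 * (P₀ * q) + (A₀ * q + a)) →
  p * suc (18 * (P₀ * q) + 2 * (A₀ * q + a)) < 36 * (P₀ * q) * u →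
  ∃ λ W → p * (2 * a + 1) < 2 * q * W × q * W < p * (a + 1)
gap-numerator {p} {u} {A₀} {P₀} {a} {q} above-lower below-upper =
  W , +-cancelˡ-< (2 * q * Y) _ _ (subst (2 * q * Y + p * (2 * a + 1) <_) (split (2 * q)) 2qY+…<2qX)
    , +-cancelˡ-< (q * Y) _ _ (subst (_< q * Y + p * (a + 1)) (split q) qX<qY+…)
  where
  X = 18 * u * P₀
  Y = p * (9 * P₀ + A₀)
  qX<qY+… : q * X < q * Y + p * (a + 1)
  qX<qY+… = subst₂ _<_ (lhs P₀ q u) (rhs p P₀ q A₀ a) above-lower
    where
    lhs : ∀ P₀ q u → 18 * (P₀ * q) * u ≡ q * (18 * u * P₀)
    lhs = solve-∀
    rhs : ∀ p P₀ q A₀ a → p * suc (9 * (P₀ * q) + (A₀ * q + a)) ≡ q * (p * (9 * P₀ + A₀)) + p * (a + 1)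
    rhs = solve-∀
  2qY+…<2qX : 2 * q * Y + p * (2 * a + 1) < 2 * q * X
  2qY+…<2qX = subst₂ _<_ (lhs p P₀ q A₀ a) (rhs P₀ q u) below-upper
    where
    lhs : ∀ p P₀ q A₀ a → p * suc (18 * (P₀ * q) + 2 * (A₀ * q + a)) ≡ 2 * q * (p * (9 * P₀ + A₀)) + p * (2 * a + 1)
    lhs = solve-∀
    rhs : ∀ P₀ q u → 36 * (P₀ * q) * u ≡ 2 * q * (18 * u * P₀)
    rhs = solve-∀
  Y≤X : Y ≤ X
  Y≤X = <⇒≤ (*-cancelˡ-< (2 * q) Y X (≤-<-trans (m≤m+n _ _) 2qY+…<2qX))
  W = X ∸ Y
  split : ∀ c → c * X ≡ c * Y + c * W
  split c = trans (cong (c *_) (sym (m+[n∸m]≡n Y≤X))) (*-distribˡ-+ c Y W)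

gap-free : ∀ {p u A P A₀ P₀ a q} → A ≡ A₀ * q + a → P ≡ P₀ * q →
  15 * (a + 1) ≡ 8 * q + 8 → 15 * (2 * a + 1) ≡ 16 * q + 1 → 8 * p ≤ q →
  18 * P * u < p * suc (9 * P + A) → p * suc (18 * P + 2 * A) < 36 * P * u → ⊥
gap-free {p} {u} {A₀ = A₀} {P₀} {a} {q} refl refl upper lower 8p≤q above-lower below-upper =
  let W , lower<W , W<upper = gap-numerator {p} {u} {A₀} {P₀} {a} {q} above-lower below-upper
  in <⇒≱ (fraction-window {a} {q} {p} {W} upper lower lower<W W<upper) 8p≤q

no-rational-in-spike-gap : ∀ p u →
  18 * wplace p * u < p * suc (9 * wplace p + wmax p) →
  p * suc (18 * wplace p + 2 * wmax p) < 36 * wplace p * u → ⊥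
no-rational-in-spike-gap p u =
  gap-free {p} {u} {wmax p} {wplace p} {wordMax (word p)} {wordPlace (word p)} {wordMax (segment p)} {wordPlace (segment p)}
    (wordMax-++ (segment p) (word p)) (wordPlace-++ (segment p) (word p)) (segment-upper p) (segment-lower p)
    (≤-trans (*-mono-≤ (≤ᵇ⇒≤ 8 14 _) (n≤1+n p)) (segment-place≥ p))

-- The two sides are the spike values 18 / (9 + r) at r = r_p⁺ and r = r_p⁻.
spike-gap : ∀ p u →
  p * suc (9 * wplace p + wmax p) ≤ 18 * wplace p * u ⊎ 36 * wplace p * u ≤ p * suc (18 * wplace p + 2 * wmax p)
spike-gap p u with p * suc (9 * wplace p + wmax p) ≤? 18 * wplace p * u
... | yes below = inj₁ below
... | no  above with 36 * wplace p * u ≤? p * suc (18 * wplace p + 2 * wmax p)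
...   | yes above′ = inj₂ above′
...   | no  below′ = ⊥-elim (no-rational-in-spike-gap p u (≰⇒> above) (≰⇒> below′))

-- The lim sup is irrational

spike≥ : ∀ {A P T M} → M * P ≤ (A + 1) * T → 18 * P * (9 * T + M) ≤ suc (9 * P + A) * (2 * 9 * T)
spike≥ {A} {P} {T} {M} M/T≤ = begin
  18 * P * (9 * T + M)           ≡⟨ expand P T M ⟩
  162 * P * T + 18 * (M * P)     ≤⟨ +-monoʳ-≤ (162 * P * T) (*-monoʳ-≤ 18 M/T≤) ⟩
  162 * P * T + 18 * ((A + 1) * T) ≡⟨ collect P A T ⟩
  suc (9 * P + A) * (2 * 9 * T)  ∎
  where
  open ≤-Reasoning
  expand : ∀ P T M → 18 * P * (9 * T + M) ≡ 162 * P * T + 18 * (M * P)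
  expand = solve-∀
  collect : ∀ P A T → 162 * P * T + 18 * ((A + 1) * T) ≡ suc (9 * P + A) * (2 * 9 * T)
  collect = solve-∀

spike≤ : ∀ {A P T M} → (2 * A + 1) * T ≤ 2 * M * P → 2 * 9 * T * suc (18 * P + 2 * A) ≤ 36 * P * (9 * T + M)
spike≤ {A} {P} {T} {M} ≤M/T = begin
  2 * 9 * T * suc (18 * P + 2 * A)    ≡⟨ expand P A T ⟩
  324 * P * T + 18 * ((2 * A + 1) * T) ≤⟨ +-monoʳ-≤ (324 * P * T) (*-monoʳ-≤ 18 ≤M/T) ⟩
  324 * P * T + 18 * (2 * M * P)      ≡⟨ collect P T M ⟩
  36 * P * (9 * T + M)                ∎
  where
  open ≤-Reasoning
  expand : ∀ P A T → 2 * 9 * T * suc (18 * P + 2 * A) ≡ 324 * P * T + 18 * ((2 * A + 1) * T)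
  expand = solve-∀
  collect : ∀ P T M → 324 * P * T + 18 * (2 * M * P) ≡ 36 * P * (9 * T + M)
  collect = solve-∀

spike≥-strictMono : ∀ {A P A′ P′} → (A′ + 1) * P < (A + 1) * P′ →
  18 * P * suc (9 * P′ + A′) < 18 * P′ * suc (9 * P + A)
spike≥-strictMono {A} {P} {A′} {P′} r′<r = begin-strict
  18 * P * suc (9 * P′ + A′)          ≡⟨ expand P P′ A′ ⟩
  162 * P * P′ + 18 * ((A′ + 1) * P)  <⟨ +-monoʳ-< (162 * P * P′) (*-monoʳ-< 18 r′<r) ⟩
  162 * P * P′ + 18 * ((A + 1) * P′)  ≡⟨ collect P A P′ ⟩
  18 * P′ * suc (9 * P + A)           ∎
  where
  open ≤-Reasoning
  expand : ∀ P P′ A′ → 18 * P * suc (9 * P′ + A′) ≡ 162 * P * P′ + 18 * ((A′ + 1) * P)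
  expand = solve-∀
  collect : ∀ P A P′ → 162 * P * P′ + 18 * ((A + 1) * P′) ≡ 18 * P′ * suc (9 * P + A)
  collect = solve-∀

spike≤-strictMono : ∀ {A P A′ P′} → (2 * A + 1) * P′ < (2 * A′ + 1) * P →
  36 * P′ * suc (18 * P + 2 * A) < 36 * P * suc (18 * P′ + 2 * A′)
spike≤-strictMono {A} {P} {A′} {P′} r<r′ = begin-strict
  36 * P′ * suc (18 * P + 2 * A)             ≡⟨ expand P A P′ ⟩
  648 * P * P′ + 36 * ((2 * A + 1) * P′)     <⟨ +-monoʳ-< (648 * P * P′) (*-monoʳ-< 36 r<r′) ⟩
  648 * P * P′ + 36 * ((2 * A′ + 1) * P)     ≡⟨ collect P P′ A′ ⟩
  36 * P * suc (18 * P′ + 2 * A′)            ∎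
  where
  open ≤-Reasoning
  expand : ∀ P A P′ → 36 * P′ * suc (18 * P + 2 * A) ≡ 648 * P * P′ + 36 * ((2 * A + 1) * P′)
  expand = solve-∀
  collect : ∀ P P′ A′ → 648 * P * P′ + 36 * ((2 * A′ + 1) * P) ≡ 36 * P * suc (18 * P′ + 2 * A′)
  collect = solve-∀

≤2∧≢2⇒≤1 : ∀ {m} → m ≤ 2 → m ≢ 2 → m ≤ 1
≤2∧≢2⇒≤1 m≤2 m≢2 with m≤n⇒m<n∨m≡n m≤2
... | inj₁ m<2 = ≤-pred m<2
... | inj₂ m≡2 = ⊥-elim (m≢2 m≡2)

spike≤-above-32/17 : ∀ {A P} → (A + 1) * 16 ≤ 9 * P → 32 * suc (18 * P + 2 * A) ≤ 36 * P * 17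
spike≤-above-32/17 {A} {P} r≤9/16 = begin
  32 * suc (18 * P + 2 * A)  ≡⟨ expand P A ⟩
  576 * P + (64 * A + 32)    ≤⟨ +-monoʳ-≤ (576 * P) (+-monoʳ-≤ (64 * A) (≤ᵇ⇒≤ 32 64 _)) ⟩
  576 * P + (64 * A + 64)    ≡⟨ cong (576 * P +_) (factor A) ⟩
  576 * P + 4 * ((A + 1) * 16) ≤⟨ +-monoʳ-≤ (576 * P) (*-monoʳ-≤ 4 r≤9/16) ⟩
  576 * P + 4 * (9 * P)      ≡⟨ collect P ⟩
  36 * P * 17                ∎
  where
  open ≤-Reasoning
  expand : ∀ P A → 32 * suc (18 * P + 2 * A) ≡ 576 * P + (64 * A + 32)
  expand = solve-∀
  factor : ∀ A → 64 * A + 64 ≡ 4 * ((A + 1) * 16)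
  factor = solve-∀
  collect : ∀ P → 576 * P + 4 * (9 * P) ≡ 36 * P * 17
  collect = solve-∀

open Construction digitSeq

word-run : ∀ j → Run (blockStart j) (word (suc j))
word-run j i i<len = digitSeq-word j i<len

spike-at-twoAt : ∀ j →
  spikeA (twoAt j) ≡ 9 * place (twoAt j) + maxA (twoAt j) × place (suc (twoAt j)) ≡ 2 * 9 * place (twoAt j)
spike-at-twoAt j = cong (λ x → (7 + x) * place (twoAt j) + maxA (twoAt j)) (digitSeq-twoAt j) ,
                   cong (λ x → 2 * (7 + x) * place (twoAt j)) (digitSeq-twoAt j)

maxA/place≤upper : ∀ J d → maxA (twoAt (d + J)) * wplace J ≤ (wmax J + 1) * place (twoAt (d + J))
maxA/place≤upper J d =
  frac-≤-trans {maxA (twoAt j)} {place (twoAt j)} {wmax j + 1} {wplace j} {wmax J + 1} {wplace J}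
    (wplace>0 j) (maxA/place≤run-upper (blockStart j) (word (suc j)) (word-run j)) (upper-antitone J d)
  where j = d + J

lower≤maxA/place : ∀ J d → 1 ≤ J →
  (2 * wmax J + 1) * place (twoAt (d + J)) ≤ 2 * maxA (twoAt (d + J)) * wplace J
lower≤maxA/place J d 1≤J =
  frac-≤-trans {2 * wmax J + 1} {wplace J} {2 * wmax j + 1} {wplace j} {2 * maxA (twoAt j)} {place (twoAt j)}
    (wplace>0 j) (lower-monotone J d)
    (run-lower≤maxA/place (blockStart j) (word (suc j)) (≤-trans 1≤J (≤-trans (m≤n+m J d) (j≤blockStart j))) (word-run j))
  where j = d + J

limsup-above : ∀ p d → p * suc (9 * wplace p + wmax p) ≤ 18 * wplace p * suc d → LimsupGt A B p d
limsup-above p d p≤spike = 18 * wplace J , 9 * wplace J + wmax J ,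
  frac-≤-<-trans {p} {suc d} {18 * wplace p} {suc (9 * wplace p + wmax p)} {18 * wplace J} {suc (9 * wplace J + wmax J)}
    z<s p≤spike (spike≥-strictMono {wmax p} {wplace p} {wmax J} {wplace J} (upper-decreasing p)) ,
  often-above (18 * wplace J) (suc (9 * wplace J + wmax J)) spikes-above
  where
  J = suc p
  spikes-above : ∀ n → ∃ λ k → n ≤ k × 18 * wplace J * spikeA k ≤ suc (9 * wplace J + wmax J) * place (suc k)
  spikes-above n = twoAt (n + J) , ≤-trans (m≤m+n n J) (j≤twoAt (n + J)) ,
    subst₂ (λ S P′ → 18 * wplace J * S ≤ suc (9 * wplace J + wmax J) * P′)
      (sym (proj₁ (spike-at-twoAt (n + J)))) (sym (proj₂ (spike-at-twoAt (n + J))))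
      (spike≥ {wmax J} {wplace J} {place (twoAt (n + J))} {maxA (twoAt (n + J))} (maxA/place≤upper J n))

limsup-below : ∀ p d → 36 * wplace p * suc d ≤ p * suc (18 * wplace p + 2 * wmax p) → LimsupLt A B p d
limsup-below p d spike≤p = 36 * wplace J , 18 * wplace J + 2 * wmax J ,
  frac-<-≤-trans {36 * wplace J} {s} {36 * wplace p} {suc (18 * wplace p + 2 * wmax p)} {p} {suc d}
    z<s (spike≤-strictMono {wmax p} {wplace p} {wmax J} {wplace J} (lower-increasing p)) spike≤p ,
  eventually-below (twoAt J) (36 * wplace J) s (λ k twoAt≤k → B-spikes k (1≤ twoAt≤k) , A-spikes k twoAt≤k (digitSeq k ≟ 2))
  where
  J = suc p
  s = suc (18 * wplace J + 2 * wmax J)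
  1≤ : ∀ {k} → twoAt J ≤ k → 1 ≤ k
  1≤ twoAt≤k = ≤-trans (s≤s z≤n) (≤-trans (j≤twoAt J) twoAt≤k)
  upper-J≤9/16 : (wmax J + 1) * 16 ≤ 9 * wplace J
  upper-J≤9/16 = frac-≤-trans {wmax J + 1} {wplace J} {wmax 1 + 1} {wplace 1} {9} {16} (wplace>0 1)
    (subst (λ j → (wmax j + 1) * wplace 1 ≤ (wmax 1 + 1) * wplace j) (+-comm p 1) (upper-antitone 1 p)) upper-at-1
  32/17≤ : 32 * s ≤ 36 * wplace J * 17
  32/17≤ = spike≤-above-32/17 {wmax J} {wplace J} upper-J≤9/16
  B-spikes : ∀ k → 1 ≤ k → 2 * place k * s ≤ 36 * wplace J * spikeB k
  B-spikes (suc k) _ = frac-≤-trans {2 * place (suc k)} {spikeB (suc k)} {7} {5} {36 * wplace J} {s} z<s (spikeB-ratio≤7/5 k)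
    (frac-≤-trans {7} {5} {32} {17} {36 * wplace J} {s} z<s (≤ᵇ⇒≤ (7 * 17) (32 * 5) _) 32/17≤)
  A-spikes : ∀ k → twoAt J ≤ k → Dec (digitSeq k ≡ 2) → place (suc k) * s ≤ 36 * wplace J * spikeA k
  A-spikes k twoAt≤k (no e≢2) =
    frac-≤-trans {place (suc k)} {spikeA k} {32} {17} {36 * wplace J} {s} z<s
      (spikeA-ratio≤ k {1} (1≤ twoAt≤k) (≤2∧≢2⇒≤1 (digitSeq≤2 k) e≢2)) 32/17≤
  A-spikes k twoAt≤k (yes e≡2) with digitSeq≡2⇒twoAt k e≡2
  ... | j , refl = subst (λ j → place (suc (twoAt j)) * s ≤ 36 * wplace J * spikeA (twoAt j)) (m∸n+n≡m J≤j) (at-twoAt (j ∸ J))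
    where
    J≤j : J ≤ j
    J≤j = twoAt-cancel-≤ twoAt≤k
    at-twoAt : ∀ d → place (suc (twoAt (d + J))) * s ≤ 36 * wplace J * spikeA (twoAt (d + J))
    at-twoAt d = subst₂ (λ P′ S → P′ * s ≤ 36 * wplace J * S)
      (sym (proj₂ (spike-at-twoAt (d + J)))) (sym (proj₁ (spike-at-twoAt (d + J))))
      (spike≤ {wmax J} {wplace J} {place (twoAt (d + J))} {maxA (twoAt (d + J))} (lower≤maxA/place J d (s≤s z≤n)))

limsup-irrational : ∀ p d → LimsupGt A B p d ⊎ LimsupLt A B p d
limsup-irrational p d with spike-gap p (suc d)
... | inj₁ p≤spike = inj₁ (limsup-above p d p≤spike)
... | inj₂ spike≤p = inj₂ (limsup-below p d spike≤p)

theorem1p2 : ∃ λ (A : SetN) → ∃ λ (B : SetN) →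
    AdditiveComplements A B ×
    LimsupGt A B 16 8 ×
    LimsupLt A B 2 0 ×
    (∀ (p d : ℕ) → LimsupGt A B p d ⊎ LimsupLt A B p d) ×
    InfinitelyOften (λ x → 1 ≤ x × count A x * count B x ≡ x + 1)
theorem1p2 =
  A , B , additive-complements ,
  limsup>16/9 (λ n → twoAt n , j≤twoAt n , digitSeq-twoAt n) ,
  limsup<2 digitSeq≤2 ,
  limsup-irrational ,
  product≡x+1-often
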